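{- For $m\ge 2$ and $n\ge 6$: \begin{enumerate} \item $\gamma(C_n\times K_m)= i(C_n\times K_m)=\gamma_{[1,2]}(C_n\times K_m)$; \item $\gamma(P_n\times K_m)= i(P_n\times K_m)=\gamma_{[1,2]}(P_n\times K_m)$. \end{enumerate}
   Context: $P_n$ is the path on $\{1,\dots,n\}$ with edges $\{i,i+1\}$; $C_n$ is the cycle on $\{1,\dots,n\}$ with edges $\{i,i+1\}$ and $\{n,1\}$; $K_m$ is the complete graph on $\{1,\dots,m\}$. The direct product $G\times H$ has vertex set $V(G)\times V(H)$ with $(g_1,h_1)\sim(g_2,h_2)$ iff $g_1g_2\in E(G)$ and $h_1h_2\in E(H)$. A set $D$ of vertices is dominating if every vertex not in $D$ is adjacent to a vertex of $D$; $\gamma(G)$ is the minimum size of a dominating set. $i(G)$ is the minimum size of a dominating set that is independent (no two of its vertices adjacent). A set $D$ is a $[1,2]$-set if every vertex not in $D$ is adjacent to at least one and at most two vertices of $D$; $\gamma_{[1,2]}(G)$ is the minimum size of a $[1,2]$-set. -}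

module Defs where

open import Data.Nat using (ℕ; zero; suc; _+_; _≤_; _≡ᵇ_; _∸_)
open import Data.Bool using (Bool; true; false; _∧_; _∨_; not; T)
open import Data.Fin using (Fin; toℕ)
open import Data.Fin.Subset using (Subset; _∈_; _∉_; ∣_∣)
open import Data.Product using (_×_; Σ; ∃; _,_)
open import Data.Vec using (lookup)
open import Data.List using (List; length; filter; allFin)
open import Relation.Nullary using (¬_)
open import Relation.Unary using (Pred)
open import Data.Bool using (_≟_)
open import Relation.Binary.PropositionalEquality using (_≡_)

-- A finite simple graph on vertex set Fin N, given by a Boolean
-- adjacency function (assumed symmetric and irreflexive for the
-- concrete graphs below; they are by construction).
record Graph : Set where
  field
    N   : ℕ
    adj : Fin N → Fin N → Bool
open Graph public

-- Vertices are 0-indexed: vertex k of Fin n stands for vertex k+1 of the paper.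
-- Path P_n: edges {i, i+1}.
pathAdj : (n : ℕ) → Fin n → Fin n → Bool
pathAdj n i j = (suc (toℕ i) ≡ᵇ toℕ j) ∨ (suc (toℕ j) ≡ᵇ toℕ i)

cycleAdj : (n : ℕ) → Fin n → Fin n → Bool
cycleAdj n i j = pathAdj n i j
  ∨ ((toℕ i ≡ᵇ n ∸ 1) ∧ (toℕ j ≡ᵇ 0))
  ∨ ((toℕ j ≡ᵇ n ∸ 1) ∧ (toℕ i ≡ᵇ 0))

completeAdj : (m : ℕ) → Fin m → Fin m → Bool
completeAdj m i j = not (toℕ i ≡ᵇ toℕ j)

P : ℕ → Graph
P n = record { N = n ; adj = pathAdj n }

C : ℕ → Graph
C n = record { N = n ; adj = cycleAdj n }

K : ℕ → Graph
K m = record { N = m ; adj = completeAdj m }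

-- Direct (tensor/categorical) product. Vertex set Fin (N G * N H),
-- identified with Fin (N G) × Fin (N H) via Data.Fin.combine / remQuot.
open import Data.Nat using (_*_)
open import Data.Fin using (remQuot)
open import Data.Product using (proj₁; proj₂)

_×ᵍ_ : Graph → Graph → Graph
G ×ᵍ H = record
  { N = N G * N H
  ; adj = λ x y →
      let x' = remQuot {N G} (N H) x
          y' = remQuot {N G} (N H) y
      in adj G (proj₁ x') (proj₁ y') ∧ adj H (proj₂ x') (proj₂ y')
  }

module _ (G : Graph) where
  Adj : Fin (N G) → Fin (N G) → Set
  Adj u v = T (adj G u v)

  nbrsIn : Subset (N G) → Fin (N G) → ℕ
  nbrsIn D v = length (filter (λ u → T? (lookup D u ∧ adj G u v)) (allFin (N G)))
    where
      open import Data.Bool.Properties using () renaming (T? to T?)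

  IsDominating : Subset (N G) → Set
  IsDominating D = ∀ v → v ∉ D → Σ (Fin (N G)) (λ u → (u ∈ D) × Adj u v)

  IsIndependent : Subset (N G) → Set
  IsIndependent D = ∀ u v → u ∈ D → v ∈ D → ¬ Adj u v

  IsIndDominating : Subset (N G) → Set
  IsIndDominating D = IsDominating D × IsIndependent D

  Is12Set : Subset (N G) → Set
  Is12Set D = ∀ v → v ∉ D → (1 ≤ nbrsIn D v) × (nbrsIn D v ≤ 2)

  IsMinOf : Pred (Subset (N G)) _ → ℕ → Set
  IsMinOf Q k = Σ (Subset (N G)) (λ D → Q D × (∣ D ∣ ≡ k))
              × (∀ D → Q D → k ≤ ∣ D ∣)

  IsDomNum : ℕ → Set
  IsDomNum = IsMinOf IsDominating

  IsIndDomNum : ℕ → Set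
  IsIndDomNum = IsMinOf IsIndDominating

  Is12DomNum : ℕ → Set
  Is12DomNum = IsMinOf Is12Set

  AllThreeEqual : Set
  AllThreeEqual = ∃ λ k → IsDomNum k × IsIndDomNum k × Is12DomNum k

{-# OPTIONS --safe #-}
module Submission where

-- The vertices of G × K_m (G = P_n or C_n) form columns {i} × K_m over the vertices i of G,
-- and a vertex (i , x) can only be dominated from the columns of the neighbours of i.
--
-- For m ≥ 2 the columns i - 1, i, i + 1 contain two vertices of a dominating
-- set D; the n windows count every column three times, so 3|D| ≥ 2n.  On a path with m ≥ 3 an
-- empty end column forces three vertices into the next two columns, so 3|D| ≥ 2n + 2.  For
-- m = 2 and G bipartite (a path or an even cycle) G × K₂ is two copies of G, each meeting D in
-- at least ⌈n/3⌉ vertices.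
--
-- Cut G into blocks of three columns a a ∅ and put one vertex into every column
-- marked a, with one label per block and different labels in consecutive blocks; this meets the
-- first two bounds.  For m = 2 it is too large on paths, and on a cycle with an odd number of
-- blocks two labels cannot alternate; there S × K₂, for an independent dominating set S of G,
-- meets the bounds instead.  These sets are independent dominating [1,2]-sets, and independent
-- dominating sets and [1,2]-sets are dominating, so one such set of minimum size gives all three.

open import Defs
open import Data.Bool using (Bool; true; false; _∧_; _∨_; not; T; if_then_else_)
open import Data.Bool.Properties using (T-∧; T-≡; T?)
open import Data.Empty using (⊥; ⊥-elim)
open import Data.Fin using (Fin; zero; suc; toℕ; fromℕ<; combine; remQuot; _↑ˡ_; _↑ʳ_)
open import Data.Fin.Properties using (remQuot-combine; combine-remQuot; toℕ<n; fromℕ<-toℕ; toℕ-fromℕ<)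
open import Data.Fin.Subset using (Subset; _∈_; _∉_; ∣_∣)
open import Data.List using (List; []; _∷_; length; filter; allFin)
import Data.List as List
open import Data.List.Membership.Propositional using () renaming (_∈_ to _∈ˡ_)
open import Data.List.Membership.Propositional.Properties using (∈-filter⁺; ∈-filter⁻; ∈-allFin; ∈-length)
open import Data.List.Relation.Unary.All using (All; []; _∷_)
open import Data.List.Relation.Unary.Any using (here)
open import Data.List.Relation.Unary.Unique.Propositional using (Unique; []; _∷_)
open import Data.Maybe using (Maybe; just; nothing; is-just)
open import Data.Maybe.Properties using (just-injective)
open import Data.Nat using (ℕ; zero; suc; _+_; _*_; _∸_; _≤_; _<_; z≤n; s≤s; s≤s⁻¹; z<s; s<s; _≡ᵇ_; _<ᵇ_; _<?_; _/_; _%_)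
open import Data.Nat.DivMod using (m≡m%n+[m/n]*n; m%n<n)
open import Data.Nat.Properties
open import Algebra.Properties.CommutativeSemigroup +-commutativeSemigroup
  using (x∙yz≈y∙xz) renaming (interchange to +-interchange)
open import Data.Nat.Tactic.RingSolver using (solve-∀)
open import Data.Product using (_×_; _,_; proj₁; proj₂; ∃-syntax; uncurry)
open import Data.Sum using (_⊎_; inj₁; inj₂; [_,_]′)
open import Data.Unit using (⊤; tt)
open import Data.Vec using ([]; _∷_; lookup; tabulate)
open import Data.Vec.Properties using (lookup∘tabulate; []=⇒lookup; lookup⇒[]=)
open import Function using (_∘_; id; const; case_of_)
open import Function.Bundles using (Equivalence)
open import Relation.Binary.PropositionalEquality
open import Relation.Nullary using (¬_; yes; no)

[_]ᵇ : Bool → ℕ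
[ true ]ᵇ  = 1
[ false ]ᵇ = 0

T⇒[]ᵇ≡1 : ∀ {b} → T b → [ b ]ᵇ ≡ 1
T⇒[]ᵇ≡1 {true} _ = refl

T⇒≡true : ∀ {b} → T b → b ≡ true
T⇒≡true = Equivalence.to T-≡

≡true⇒T : ∀ {b} → b ≡ true → T b
≡true⇒T = Equivalence.from T-≡

¬T⇒≡false : ∀ {b} → ¬ T b → b ≡ false
¬T⇒≡false {true}  ¬t = ⊥-elim (¬t tt)
¬T⇒≡false {false} _  = refl

T-∧-intro : ∀ {a b} → T a → T b → T (a ∧ b)
T-∧-intro ta tb = Equivalence.from T-∧ (ta , tb)

T-∧-elim : ∀ {a b} → T (a ∧ b) → T a × T b
T-∧-elim = Equivalence.to T-∧

T-∨-introˡ : ∀ {a} b → T a → T (a ∨ b)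
T-∨-introˡ {true} _ _ = tt

T-∨-introʳ : ∀ a {b} → T b → T (a ∨ b)
T-∨-introʳ true  _ = tt
T-∨-introʳ false t = t

T-∨-elim : ∀ a {b} → T (a ∨ b) → T a ⊎ T b
T-∨-elim true  _ = inj₁ tt
T-∨-elim false t = inj₂ t

≡⇒≡ᵇ≡true : ∀ {a b} → a ≡ b → (a ≡ᵇ b) ≡ true
≡⇒≡ᵇ≡true {a} {b} eq = T⇒≡true (≡⇒≡ᵇ a b eq)

≢⇒≡ᵇ≡false : ∀ {a b} → a ≢ b → (a ≡ᵇ b) ≡ false
≢⇒≡ᵇ≡false {a} {b} a≢b = ¬T⇒≡false (a≢b ∘ ≡ᵇ⇒≡ a b)

T-≢ᵇ⇒≢ : ∀ {a b} → T (not (a ≡ᵇ b)) → a ≢ b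
T-≢ᵇ⇒≢ {a} t refl = subst (T ∘ not) (≡⇒≡ᵇ≡true {a} refl) t

≢⇒T-≢ᵇ : ∀ {a b} → a ≢ b → T (not (a ≡ᵇ b))
≢⇒T-≢ᵇ a≢b rewrite ≢⇒≡ᵇ≡false a≢b = tt

∑ : ℕ → (ℕ → ℕ) → ℕ
∑ zero    f = 0
∑ (suc n) f = f 0 + ∑ n (f ∘ suc)

syntax ∑ n (λ i → e) = ∑[ i < n ] e

# : ℕ → (ℕ → Bool) → ℕ
# n p = ∑[ i < n ] [ p i ]ᵇ

syntax # n (λ i → e) = #[ i < n ] e

∑-cong : ∀ n {f g : ℕ → ℕ} → (∀ {i} → i < n → f i ≡ g i) → ∑ n f ≡ ∑ n g
∑-cong zero    eq = refl
∑-cong (suc n) eq = cong₂ _+_ (eq z<s) (∑-cong n (eq ∘ s<s))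

∑-mono-≤ : ∀ n {f g : ℕ → ℕ} → (∀ {i} → i < n → f i ≤ g i) → ∑ n f ≤ ∑ n g
∑-mono-≤ zero    le = z≤n
∑-mono-≤ (suc n) le = +-mono-≤ (le z<s) (∑-mono-≤ n (le ∘ s<s))

∑-distrib-+ : ∀ n (f g : ℕ → ℕ) → ∑[ i < n ] (f i + g i) ≡ ∑ n f + ∑ n g
∑-distrib-+ zero    f g = refl
∑-distrib-+ (suc n) f g =
  trans (cong (f 0 + g 0 +_) (∑-distrib-+ n (f ∘ suc) (g ∘ suc))) (+-interchange (f 0) (g 0) _ _)

∑-last : ∀ n (f : ℕ → ℕ) → ∑ (suc n) f ≡ ∑ n f + f n
∑-last zero    f = +-comm (f 0) 0
∑-last (suc n) f = trans (cong (f 0 +_) (∑-last n (f ∘ suc))) (sym (+-assoc (f 0) _ _))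

*≤∑ : ∀ n {k} (f : ℕ → ℕ) → (∀ {i} → i < n → k ≤ f i) → n * k ≤ ∑ n f
*≤∑ zero    f le = z≤n
*≤∑ (suc n) f le = +-mono-≤ (le z<s) (*≤∑ n (f ∘ suc) (le ∘ s<s))

∑-shiftʳ : ∀ k (c p : ℕ → ℕ) → (∀ {i} → i < k → p (suc i) ≡ i) →
           ∑ (suc k) (c ∘ p) + c k ≡ c (p 0) + ∑ (suc k) c
∑-shiftʳ k c p p-suc = begin
  (c (p 0) + ∑ k (c ∘ p ∘ suc)) + c k   ≡⟨ +-assoc (c (p 0)) _ _ ⟩
  c (p 0) + (∑ k (c ∘ p ∘ suc) + c k)   ≡⟨ cong (λ s → c (p 0) + (s + c k)) (∑-cong k (cong c ∘ p-suc)) ⟩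
  c (p 0) + (∑ k c + c k)               ≡⟨ cong (c (p 0) +_) (∑-last k c) ⟨
  c (p 0) + ∑ (suc k) c                 ∎
  where open ≡-Reasoning

∑-shiftˡ : ∀ k (c s : ℕ → ℕ) → (∀ {i} → i < k → s i ≡ suc i) →
           ∑ (suc k) (c ∘ s) + c 0 ≡ ∑ (suc k) c + c (s k)
∑-shiftˡ k c s s-suc = begin
  ∑ (suc k) (c ∘ s) + c 0               ≡⟨ cong (_+ c 0) (∑-last k (c ∘ s)) ⟩
  (∑ k (c ∘ s) + c (s k)) + c 0         ≡⟨ cong (λ t → (t + c (s k)) + c 0) (∑-cong k (cong c ∘ s-suc)) ⟩
  (∑ k (c ∘ suc) + c (s k)) + c 0       ≡⟨ +-comm _ (c 0) ⟩
  c 0 + (∑ k (c ∘ suc) + c (s k))       ≡⟨ +-assoc (c 0) _ _ ⟨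
  ∑ (suc k) c + c (s k)                 ∎
  where open ≡-Reasoning

#≡0 : ∀ m (p : ℕ → Bool) → (∀ {b} → b < m → ¬ T (p b)) → # m p ≡ 0
#≡0 zero    p none = refl
#≡0 (suc m) p none with p 0 in p0
... | true  = ⊥-elim (none z<s (≡true⇒T p0))
... | false = #≡0 m (p ∘ suc) (none ∘ s<s)

#-remove : ∀ {m b} (p : ℕ → Bool) → b < m → # m p ≡ [ p b ]ᵇ + #[ c < m ] (not (c ≡ᵇ b) ∧ p c)
#-remove {suc m} {zero}  p _         = refl
#-remove {suc m} {suc b} p (s<s b<m) = begin
  [ p 0 ]ᵇ + # m (p ∘ suc)                                              ≡⟨ cong ([ p 0 ]ᵇ +_) (#-remove (p ∘ suc) b<m) ⟩
  [ p 0 ]ᵇ + ([ p (suc b) ]ᵇ + #[ c < m ] (not (c ≡ᵇ b) ∧ p (suc c)))   ≡⟨ x∙yz≈y∙xz [ p 0 ]ᵇ [ p (suc b) ]ᵇ _ ⟩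
  [ p (suc b) ]ᵇ + ([ p 0 ]ᵇ + #[ c < m ] (not (c ≡ᵇ b) ∧ p (suc c)))   ∎
  where open ≡-Reasoning

length≤# : ∀ {m} {bs : List ℕ} (p : ℕ → Bool) → Unique bs → All (λ b → b < m × T (p b)) bs → length bs ≤ # m p
length≤# p [] [] = z≤n
length≤# {m} {b ∷ bs} p (b≢bs ∷ unique) ((b<m , pb) ∷ rest) = begin
  suc (length bs)                             ≤⟨ s≤s (length≤# _ unique (others b≢bs rest)) ⟩
  suc (#[ c < m ] (not (c ≡ᵇ b) ∧ p c))       ≡⟨ cong (_+ #[ c < m ] (not (c ≡ᵇ b) ∧ p c)) (T⇒[]ᵇ≡1 pb) ⟨
  [ p b ]ᵇ + #[ c < m ] (not (c ≡ᵇ b) ∧ p c)   ≡⟨ #-remove p b<m ⟨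
  # m p                                       ∎
  where
  open ≤-Reasoning
  others : ∀ {cs} → All (b ≢_) cs → All (λ c → c < m × T (p c)) cs → All (λ c → c < m × T (not (c ≡ᵇ b) ∧ p c)) cs
  others []             []               = []
  others (b≢c ∷ b≢cs) ((c<m , pc) ∷ cs) = (c<m , T-∧-intro (≢⇒T-≢ᵇ (b≢c ∘ sym)) pc) ∷ others b≢cs cs

1≤# : ∀ {m b} (p : ℕ → Bool) → b < m → T (p b) → 1 ≤ # m p
1≤# p b<m pb = length≤# p ([] ∷ []) ((b<m , pb) ∷ [])

2≤# : ∀ {m b c} (p : ℕ → Bool) → b < m → c < m → b ≢ c → T (p b) → T (p c) → 2 ≤ # m p
2≤# p b<m c<m b≢c pb pc = length≤# p ((b≢c ∷ []) ∷ [] ∷ []) ((b<m , pb) ∷ (c<m , pc) ∷ [])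

#≡0⇒¬T : ∀ {m b} (p : ℕ → Bool) → # m p ≡ 0 → b < m → ¬ T (p b)
#≡0⇒¬T p #≡0 b<m pb = 1+n≰n (subst (1 ≤_) #≡0 (1≤# p b<m pb))

#≤1 : ∀ m (p : ℕ → Bool) → (∀ {b c} → b < m → c < m → T (p b) → T (p c) → b ≡ c) → # m p ≤ 1
#≤1 zero    p unique = z≤n
#≤1 (suc m) p unique with p 0 in p0
... | true  = ≤-reflexive (cong suc (#≡0 m (p ∘ suc) λ b<m pb → 0≢1+n (unique z<s (s<s b<m) (≡true⇒T p0) pb)))
... | false = #≤1 m (p ∘ suc) λ b<m c<m pb pc → suc-injective (unique (s<s b<m) (s<s c<m) pb pc)

#-≡ᵇ : ∀ {m a} → a < m → #[ b < m ] (a ≡ᵇ b) ≡ 1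
#-≡ᵇ {m} {a} a<m = ≤-antisym (#≤1 m (a ≡ᵇ_) λ {b} {c} _ _ ab ac → trans (sym (≡ᵇ⇒≡ a b ab)) (≡ᵇ⇒≡ a c ac))
                             (1≤# (a ≡ᵇ_) a<m (≡⇒≡ᵇ a a refl))

#-true : ∀ r → #[ j < r ] true ≡ r
#-true zero    = refl
#-true (suc r) = cong suc (#-true r)

nonempty⇒∈ : ∀ {A : Set} {xs : List A} → 1 ≤ length xs → ∃[ x ] x ∈ˡ xs
nonempty⇒∈ {xs = x ∷ _} _ = x , here refl

LowerBound : Graph → ℕ → Set
LowerBound G k = ∀ D → IsDominating G D → k ≤ ∣ D ∣

module _ (G : Graph) where

  ∈⇒T : ∀ {D : Subset (N G)} {u} → u ∈ D → T (lookup D u)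
  ∈⇒T u∈D = ≡true⇒T ([]=⇒lookup u∈D)

  T⇒∈ : ∀ {D : Subset (N G)} {u} → T (lookup D u) → u ∈ D
  T⇒∈ {D} {u} t = lookup⇒[]= u D (T⇒≡true t)

  nbrsIn-pos : ∀ {D u v} → u ∈ D → Adj G u v → 1 ≤ nbrsIn G D v
  nbrsIn-pos {D} {u} {v} u∈D uv =
    ∈-length (∈-filter⁺ (λ w → T? (lookup D w ∧ adj G w v)) (∈-allFin u) (T-∧-intro (∈⇒T {D} u∈D) uv))

  nbrsIn-pos⁻ : ∀ {D v} → 1 ≤ nbrsIn G D v → ∃[ u ] u ∈ D × Adj G u v
  nbrsIn-pos⁻ {D} {v} pos with u , u∈ ← nonempty⇒∈ pos
    with _ , held ← ∈-filter⁻ (λ w → T? (lookup D w ∧ adj G w v)) {xs = allFin (N G)} u∈ =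
    u , T⇒∈ {D} (proj₁ (T-∧-elim held)) , proj₂ (T-∧-elim held)

  [1,2]-set⇒dominating : ∀ {D} → Is12Set G D → IsDominating G D
  [1,2]-set⇒dominating [1,2] v v∉D = nbrsIn-pos⁻ (proj₁ ([1,2] v v∉D))

  allThreeEqual : ∀ {D} → IsDominating G D → IsIndependent G D → Is12Set G D → LowerBound G ∣ D ∣ →
                  AllThreeEqual G
  allThreeEqual {D} dom ind [1,2] minimal =
    ∣ D ∣ , ((D , dom , refl) , minimal)
          , ((D , (dom , ind) , refl) , λ D′ → minimal D′ ∘ proj₁)
          , ((D , [1,2] , refl) , λ D′ → minimal D′ ∘ [1,2]-set⇒dominating)

-- Vertex sets of G × K_m in column coordinates

∑ᶠ : ∀ N → (Fin N → ℕ) → ℕ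
∑ᶠ zero    f = 0
∑ᶠ (suc N) f = f zero + ∑ᶠ N (f ∘ suc)

∑ᶠ-↑ : ∀ a b (f : Fin (a + b) → ℕ) → ∑ᶠ (a + b) f ≡ ∑ᶠ a (f ∘ (_↑ˡ b)) + ∑ᶠ b (f ∘ (a ↑ʳ_))
∑ᶠ-↑ zero    b f = refl
∑ᶠ-↑ (suc a) b f = trans (cong (f zero +_) (∑ᶠ-↑ a b (f ∘ suc))) (sym (+-assoc (f zero) _ _))

∑ᶠ-combine : ∀ n m (f : Fin (n * m) → ℕ) → ∑ᶠ (n * m) f ≡ ∑ᶠ n (λ i → ∑ᶠ m (λ a → f (combine i a)))
∑ᶠ-combine zero    m f = refl
∑ᶠ-combine (suc n) m f =
  trans (∑ᶠ-↑ m (n * m) f) (cong (∑ᶠ m (f ∘ (_↑ˡ (n * m))) +_) (∑ᶠ-combine n m (f ∘ (m ↑ʳ_))))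

∑ᶠ≡∑ : ∀ N {f : Fin N → ℕ} {g : ℕ → ℕ} → (∀ i → f i ≡ g (toℕ i)) → ∑ᶠ N f ≡ ∑ N g
∑ᶠ≡∑ zero    eq = refl
∑ᶠ≡∑ (suc N) eq = cong₂ _+_ (eq zero) (∑ᶠ≡∑ N (eq ∘ suc))

∣∣≡∑ᶠ : ∀ {N} (D : Subset N) → ∣ D ∣ ≡ ∑ᶠ N (λ u → [ lookup D u ]ᵇ)
∣∣≡∑ᶠ []          = refl
∣∣≡∑ᶠ (true ∷ D)  = cong suc (∣∣≡∑ᶠ D)
∣∣≡∑ᶠ (false ∷ D) = ∣∣≡∑ᶠ D

length-filter-tabulate : ∀ {A : Set} N (h : Fin N → A) (p : A → Bool) →
                         length (filter (T? ∘ p) (List.tabulate h)) ≡ ∑ᶠ N (λ u → [ p (h u) ]ᵇ)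
length-filter-tabulate zero    h p = refl
length-filter-tabulate (suc N) h p with p (h zero)
... | true  = cong suc (length-filter-tabulate N (h ∘ suc) p)
... | false = length-filter-tabulate N (h ∘ suc) p

-- A graph on {0, …, n-1} given by a Boolean adjacency on ℕ; the concrete graphs P n and C n
-- of Defs are definitionally of this form.
graphOn : (n : ℕ) → (ℕ → ℕ → Bool) → Graph
graphOn n X = record { N = n ; adj = λ i j → X (toℕ i) (toℕ j) }

-- A vertex set of graphOn n X ×ᵍ K m is described by F : ℕ → ℕ → Bool, where F j b says
-- whether (j , b) belongs to it: j is the column (a vertex of the base graph), b the label.
module Product (n m : ℕ) (X : ℕ → ℕ → Bool) where

  G : Graph
  G = graphOn n X ×ᵍ K m

  adj-combine : ∀ i a j b → adj G (combine i a) (combine j b) ≡ X (toℕ i) (toℕ j) ∧ not (toℕ a ≡ᵇ toℕ b)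
  adj-combine i a j b = cong₂ adjPair (remQuot-combine i a) (remQuot-combine j b)
    where
    adjPair : Fin n × Fin m → Fin n × Fin m → Bool
    adjPair (i , a) (j , b) = X (toℕ i) (toℕ j) ∧ not (toℕ a ≡ᵇ toℕ b)

  split : ∀ u → ∃[ j ] ∃[ b ] u ≡ combine j b
  split u = proj₁ (remQuot {n} m u) , proj₂ (remQuot {n} m u) , sym (combine-remQuot {n} m u)

  every-combine : (P : Fin (n * m) → Set) → (∀ i a → P (combine i a)) → ∀ v → P v
  every-combine P P-combine v = subst P (combine-remQuot {n} m v) (uncurry P-combine (remQuot {n} m v))

  record Dominator (F : ℕ → ℕ → Bool) (i x : ℕ) : Set where
    constructor dominator
    field
      col lab  : ℕ
      col<n    : col < n
      lab<m    : lab < m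
      held     : T (F col lab)
      adjacent : T (X col i)
      lab≢     : lab ≢ x

  Dominates : (ℕ → ℕ → Bool) → Set
  Dominates F = ∀ {i x} → i < n → x < m → ¬ T (F i x) → Dominator F i x

  Independent : (ℕ → ℕ → Bool) → Set
  Independent F = ∀ {i a j b} → T (F i a) → T (F j b) → T (X i j) → a ≡ b

  OnePerColumn : (ℕ → ℕ → Bool) → Set
  OnePerColumn F = ∀ {j x b c} → x < m → T (F j b) → T (F j c) → b ≢ x → c ≢ x → b ≡ c

  count : (ℕ → ℕ → Bool) → ℕ → ℕ
  count F j = #[ b < m ] F j b

  size : (ℕ → ℕ → Bool) → ℕ
  size F = ∑[ j < n ] count F j

  ∑ᶠ≡∑∑ : {f : Fin (n * m) → ℕ} {g : ℕ → ℕ → ℕ} → (∀ i a → f (combine i a) ≡ g (toℕ i) (toℕ a)) →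
          ∑ᶠ (n * m) f ≡ ∑[ j < n ] ∑[ b < m ] g j b
  ∑ᶠ≡∑∑ {f} eq = trans (∑ᶠ-combine n m f) (∑ᶠ≡∑ n (λ i → ∑ᶠ≡∑ m (eq i)))

  toColumns : Subset (n * m) → ℕ → ℕ → Bool
  toColumns D j b with j <? n | b <? m
  ... | yes j<n | yes b<m = lookup D (combine (fromℕ< j<n) (fromℕ< b<m))
  ... | _       | _       = false

  toColumns-combine : ∀ D i a → toColumns D (toℕ i) (toℕ a) ≡ lookup D (combine i a)
  toColumns-combine D i a with toℕ i <? n | toℕ a <? m
  ... | yes i<n | yes a<m = cong₂ (λ i a → lookup D (combine i a)) (fromℕ<-toℕ i i<n) (fromℕ<-toℕ a a<m)
  ... | no i≮n  | _       = ⊥-elim (i≮n (toℕ<n i))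
  ... | yes _   | no a≮m  = ⊥-elim (a≮m (toℕ<n a))

  toColumns-col< : ∀ D {j b} → T (toColumns D j b) → j < n
  toColumns-col< D {j} {b} held with j <? n | b <? m
  ... | yes j<n | yes _ = j<n

  count-toColumns-n : ∀ D → count (toColumns D) n ≡ 0
  count-toColumns-n D = #≡0 m _ (λ _ h → <-irrefl refl (toColumns-col< D h))

  ∣∣≡size-toColumns : ∀ D → ∣ D ∣ ≡ size (toColumns D)
  ∣∣≡size-toColumns D = trans (∣∣≡∑ᶠ D) (∑ᶠ≡∑∑ (λ i a → cong [_]ᵇ (sym (toColumns-combine D i a))))

  toColumns-dominates : ∀ {D} → IsDominating G D → Dominates (toColumns D)
  toColumns-dominates {D} dom {i} {x} i<n x<m ¬held with dom (combine i′ x′) v∉D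
    where
    i′ : Fin n
    i′ = fromℕ< i<n
    x′ : Fin m
    x′ = fromℕ< x<m
    v∉D : combine i′ x′ ∉ D
    v∉D v∈D = ¬held (subst T (trans (sym (toColumns-combine D i′ x′)) (cong₂ (toColumns D) (toℕ-fromℕ< i<n) (toℕ-fromℕ< x<m)))
                            (∈⇒T G {D} v∈D))
  ... | u , u∈D , uv with j , b , refl ← split u =
    dominator (toℕ j) (toℕ b) (toℕ<n j) (toℕ<n b) (subst T (sym (toColumns-combine D j b)) (∈⇒T G {D} u∈D))
              (proj₁ uv′) (T-≢ᵇ⇒≢ (proj₂ uv′))
    where
    uv′ : T (X (toℕ j) i) × T (not (toℕ b ≡ᵇ x))
    uv′ = T-∧-elim (subst T (trans (adj-combine j b _ _)
                                   (cong₂ (λ i x → X (toℕ j) i ∧ not (toℕ b ≡ᵇ x)) (toℕ-fromℕ< i<n) (toℕ-fromℕ< x<m))) uv)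

  fromColumns : (ℕ → ℕ → Bool) → Subset (n * m)
  fromColumns F = tabulate (uncurry (λ i a → F (toℕ i) (toℕ a)) ∘ remQuot {n} m)

  lookup-fromColumns : ∀ F i a → lookup (fromColumns F) (combine i a) ≡ F (toℕ i) (toℕ a)
  lookup-fromColumns F i a = trans (lookup∘tabulate _ (combine i a))
                                  (cong (uncurry (λ i a → F (toℕ i) (toℕ a))) (remQuot-combine {n} {m} i a))

  ∣fromColumns∣ : ∀ F → ∣ fromColumns F ∣ ≡ size F
  ∣fromColumns∣ F = trans (∣∣≡∑ᶠ (fromColumns F)) (∑ᶠ≡∑∑ (λ i a → cong [_]ᵇ (lookup-fromColumns F i a)))

  fromColumns-dominating : ∀ {F} → Dominates F → IsDominating G (fromColumns F)
  fromColumns-dominating {F} dom = every-combine _ λ i a v∉ →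
    let dominator j b j<n b<m held ji b≢a = dom (toℕ<n i) (toℕ<n a) (v∉ ∘ T⇒∈ G ∘ subst T (sym (lookup-fromColumns F i a)))
        j′ , b′ = fromℕ< j<n , fromℕ< b<m
    in combine j′ b′
     , T⇒∈ G (subst T (sym (trans (lookup-fromColumns F j′ b′) (cong₂ F (toℕ-fromℕ< j<n) (toℕ-fromℕ< b<m)))) held)
     , subst T (sym (trans (adj-combine j′ b′ i a) (cong₂ (λ j b → X j (toℕ i) ∧ not (b ≡ᵇ toℕ a)) (toℕ-fromℕ< j<n) (toℕ-fromℕ< b<m))))
               (T-∧-intro ji (≢⇒T-≢ᵇ b≢a))

  fromColumns-independent : ∀ {F} → Independent F → IsIndependent G (fromColumns F)
  fromColumns-independent {F} ind = every-combine _ λ i a → every-combine _ λ j b ia∈ jb∈ adjacent →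
    let X-ij , a≢b = T-∧-elim (subst T (adj-combine i a j b) adjacent)
    in T-≢ᵇ⇒≢ a≢b (ind (held i a ia∈) (held j b jb∈) X-ij)
    where
    held : ∀ i a → combine i a ∈ fromColumns F → T (F (toℕ i) (toℕ a))
    held i a ia∈ = subst T (lookup-fromColumns F i a) (∈⇒T G ia∈)

  degree : ℕ → ℕ
  degree i = #[ j < n ] X j i

  nbrsIn-fromColumns : ∀ F i a → nbrsIn G (fromColumns F) (combine i a) ≡
                       ∑[ j < n ] #[ b < m ] (F j b ∧ (X j (toℕ i) ∧ not (b ≡ᵇ toℕ a)))
  nbrsIn-fromColumns F i a = trans (length-filter-tabulate (n * m) id _)
    (∑ᶠ≡∑∑ (λ j b → cong [_]ᵇ (cong₂ _∧_ (lookup-fromColumns F j b) (adj-combine j b i a))))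

  fromColumns-[1,2] : ∀ {F} → Dominates F → OnePerColumn F → (∀ {i} → i < n → degree i ≤ 2) →
                      Is12Set G (fromColumns F)
  fromColumns-[1,2] {F} dom one deg = every-combine _ λ i a v∉ →
    let u , u∈ , uv = fromColumns-dominating dom _ v∉
    in nbrsIn-pos G u∈ uv
     , (begin
         nbrsIn G (fromColumns F) (combine i a)                              ≡⟨ nbrsIn-fromColumns F i a ⟩
         ∑[ j < n ] #[ b < m ] (F j b ∧ (X j (toℕ i) ∧ not (b ≡ᵇ toℕ a)))    ≤⟨ ∑-mono-≤ n (λ {j} _ → column (toℕ<n a) j) ⟩
         degree (toℕ i)                                                     ≤⟨ deg (toℕ<n i) ⟩
         2                                                                  ∎)
    where
    open ≤-Reasoning
    column : ∀ {i x} → x < m → ∀ j → #[ b < m ] (F j b ∧ (X j i ∧ not (b ≡ᵇ x))) ≤ [ X j i ]ᵇ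
    column {i} {x} x<m j with X j i
    ... | true  = #≤1 m _ λ _ _ hb hc →
                    let Fb , ¬b = T-∧-elim hb
                        Fc , ¬c = T-∧-elim hc
                    in one x<m Fb Fc (T-≢ᵇ⇒≢ ¬b) (T-≢ᵇ⇒≢ ¬c)
    ... | false = ≤-reflexive (#≡0 m _ λ _ h → proj₂ (T-∧-elim h))

  record Construction (k : ℕ) : Set where
    field
      set            : ℕ → ℕ → Bool
      dominates      : Dominates set
      independent    : Independent set
      one-per-column : OnePerColumn set
      size≡          : size set ≡ k

  optimal : ∀ {k} → (∀ {i} → i < n → degree i ≤ 2) → Construction k → LowerBound G k → AllThreeEqual G
  optimal deg c lower = allThreeEqual G
    (fromColumns-dominating dominates) (fromColumns-independent independent)
    (fromColumns-[1,2] dominates one-per-column deg)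
    (λ D′ → ≤-trans (≤-reflexive (trans (∣fromColumns∣ set) size≡)) ∘ lower D′)
    where open Construction c

-- Paths and cycles

-- At the two ends these are either the
-- wrap-around neighbour (cycles) or the absent column n (paths), which holds no vertex of
-- any set we consider.
record PathLike (n : ℕ) (X : ℕ → ℕ → Bool) : Set where
  field
    prev next  : ℕ → ℕ
    prev-suc   : ∀ {i} → suc i < n → prev (suc i) ≡ i
    next-suc   : ∀ {i} → suc i < n → next i ≡ suc i
    prev-first : prev 0 ≡ n ∸ 1 ⊎ prev 0 ≡ n
    next-last  : next (n ∸ 1) ≡ 0 ⊎ next (n ∸ 1) ≡ n
    nbr⇒       : ∀ {i j} → i < n → j < n → T (X j i) → j ≡ prev i ⊎ j ≡ next i
    prev-adj   : ∀ {i} → i < n → prev i < n → T (X (prev i) i)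
    next-adj   : ∀ {i} → i < n → next i < n → T (X (next i) i)

infixr 5 _∷ˢ_

_∷ˢ_ : {A : Set} → A → (ℕ → A) → ℕ → A
(x ∷ˢ s) zero    = x
(x ∷ˢ s) (suc i) = s i

pathᵇ : ℕ → ℕ → Bool
pathᵇ i j = (suc i ≡ᵇ j) ∨ (suc j ≡ᵇ i)

cycᵇ : ℕ → ℕ → ℕ → Bool
cycᵇ n i j = pathᵇ i j
  ∨ ((i ≡ᵇ n ∸ 1) ∧ (j ≡ᵇ 0))
  ∨ ((j ≡ᵇ n ∸ 1) ∧ (i ≡ᵇ 0))

pathᵇ⇒ : ∀ {i j} → T (pathᵇ i j) → suc i ≡ j ⊎ suc j ≡ i
pathᵇ⇒ {i} {j} t with T-∨-elim (suc i ≡ᵇ j) t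
... | inj₁ e = inj₁ (≡ᵇ⇒≡ _ _ e)
... | inj₂ e = inj₂ (≡ᵇ⇒≡ _ _ e)

pathᵇ-suc : ∀ i → T (pathᵇ i (suc i))
pathᵇ-suc i = T-∨-introˡ _ (≡⇒≡ᵇ (suc i) (suc i) refl)

pathᵇ-pred : ∀ i → T (pathᵇ (suc i) i)
pathᵇ-pred i = T-∨-introʳ (suc (suc i) ≡ᵇ i) (≡⇒≡ᵇ (suc i) (suc i) refl)

path : ∀ {n} → 0 < n → PathLike n pathᵇ
path {suc k} _ = record
  { prev       = suc k ∷ˢ id
  ; next       = suc
  ; prev-suc   = λ _ → refl
  ; next-suc   = λ _ → refl
  ; prev-first = inj₂ refl
  ; next-last  = inj₂ refl
  ; nbr⇒       = nbr⇒
  ; prev-adj   = prev-adj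
  ; next-adj   = λ {i} _ _ → pathᵇ-pred i
  }
  where
  nbr⇒ : ∀ {i j} → i < suc k → j < suc k → T (pathᵇ j i) → j ≡ (suc k ∷ˢ id) i ⊎ j ≡ suc i
  nbr⇒ {i} {j} _ _ t with pathᵇ⇒ {j} {i} t
  ... | inj₁ refl = inj₁ refl
  ... | inj₂ refl = inj₂ refl
  prev-adj : ∀ {i} → i < suc k → (suc k ∷ˢ id) i < suc k → T (pathᵇ ((suc k ∷ˢ id) i) i)
  prev-adj {zero}  _ k<k = ⊥-elim (<-irrefl refl k<k)
  prev-adj {suc i} _ _   = pathᵇ-suc i

data CycleEdge (n i j : ℕ) : Set where
  forward  : suc i ≡ j → CycleEdge n i j
  backward : suc j ≡ i → CycleEdge n i j
  wrap     : i ≡ n ∸ 1 → j ≡ 0 → CycleEdge n i j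
  wrap⁻¹   : j ≡ n ∸ 1 → i ≡ 0 → CycleEdge n i j

cycᵇ⇒ : ∀ {n i j} → T (cycᵇ n i j) → CycleEdge n i j
cycᵇ⇒ {n} {i} {j} t with T-∨-elim (pathᵇ i j) t
... | inj₁ p = [ forward , backward ]′ (pathᵇ⇒ p)
... | inj₂ t′ with T-∨-elim ((i ≡ᵇ n ∸ 1) ∧ (j ≡ᵇ 0)) t′
...   | inj₁ w = let a , b = T-∧-elim w in wrap (≡ᵇ⇒≡ _ _ a) (≡ᵇ⇒≡ _ _ b)
...   | inj₂ w = let a , b = T-∧-elim w in wrap⁻¹ (≡ᵇ⇒≡ _ _ a) (≡ᵇ⇒≡ _ _ b)

cycᵇ-path : ∀ n i j → T (pathᵇ i j) → T (cycᵇ n i j)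
cycᵇ-path n i j = T-∨-introˡ _

cycᵇ-wrap : ∀ n → T (cycᵇ n (n ∸ 1) 0)
cycᵇ-wrap n = T-∨-introʳ (pathᵇ (n ∸ 1) 0) (T-∨-introˡ _ (T-∧-intro (≡⇒≡ᵇ (n ∸ 1) (n ∸ 1) refl) tt))

cycᵇ-wrap⁻¹ : ∀ n → T (cycᵇ n 0 (n ∸ 1))
cycᵇ-wrap⁻¹ n = T-∨-introʳ (pathᵇ 0 (n ∸ 1)) (T-∨-introʳ ((0 ≡ᵇ n ∸ 1) ∧ _) (T-∧-intro (≡⇒≡ᵇ (n ∸ 1) (n ∸ 1) refl) tt))

cycleNext : ℕ → ℕ → ℕ
cycleNext n i = if suc i ≡ᵇ n then 0 else suc i

cycleNext-cases : ∀ n i → (suc i ≢ n × cycleNext n i ≡ suc i) ⊎ (suc i ≡ n × cycleNext n i ≡ 0)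
cycleNext-cases n i with suc i ≟ n
... | yes eq rewrite ≡⇒≡ᵇ≡true eq = inj₂ (eq , refl)
... | no  ne rewrite ≢⇒≡ᵇ≡false ne = inj₁ (ne , refl)

cycle : ∀ {n} → 3 ≤ n → PathLike n (cycᵇ n)
cycle {1} (s≤s ())
cycle {2} (s≤s (s≤s ()))
cycle {n@(suc (suc (suc _)))} _ = record
  { prev       = n ∸ 1 ∷ˢ id
  ; next       = cycleNext n
  ; prev-suc   = λ _ → refl
  ; next-suc   = λ i+1<n → next-inner (<⇒≢ i+1<n)
  ; prev-first = inj₁ refl
  ; next-last  = inj₁ next-end
  ; nbr⇒       = nbr⇒
  ; prev-adj   = λ {i} _ _ → prev-adj i
  ; next-adj   = λ {i} _ _ → next-adj i
  }
  where
  next-inner : ∀ {i} → suc i ≢ n → cycleNext n i ≡ suc i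
  next-inner i+1≢n rewrite ≢⇒≡ᵇ≡false i+1≢n = refl
  next-end : cycleNext n (n ∸ 1) ≡ 0
  next-end rewrite ≡⇒≡ᵇ≡true {n} refl = refl
  nbr⇒ : ∀ {i j} → i < n → j < n → T (cycᵇ n j i) → j ≡ (n ∸ 1 ∷ˢ id) i ⊎ j ≡ cycleNext n i
  nbr⇒ {i} {j} _ j<n t with cycᵇ⇒ {n} {j} {i} t
  ... | forward refl     = inj₁ refl
  ... | backward refl    = inj₂ (sym (next-inner (<⇒≢ j<n)))
  ... | wrap refl refl   = inj₁ refl
  ... | wrap⁻¹ refl refl = inj₂ (sym next-end)
  prev-adj : ∀ i → T (cycᵇ n ((n ∸ 1 ∷ˢ id) i) i)
  prev-adj zero    = cycᵇ-wrap n
  prev-adj (suc i) = cycᵇ-path n i (suc i) (pathᵇ-suc i)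
  next-adj : ∀ i → T (cycᵇ n (cycleNext n i) i)
  next-adj i with cycleNext-cases n i
  ... | inj₁ (i+1≢n , eq) rewrite eq = cycᵇ-path n (suc i) i (pathᵇ-pred i)
  ... | inj₂ (refl , eq)  rewrite eq = cycᵇ-wrap⁻¹ n

module _ {A : Set} where

  Windows : (A → A → A → Set) → ℕ → (ℕ → A) → Set
  Windows OK zero    s = ⊤
  Windows OK (suc n) s = OK (s 0) (s 1) (s 2) × Windows OK n (s ∘ suc)

  windows-at : ∀ {OK n s i} → Windows OK n s → i < n → OK (s i) (s (suc i)) (s (suc (suc i)))
  windows-at {i = zero}  (w , _)  z<s       = w
  windows-at {i = suc i} (_ , ws) (s<s i<n) = windows-at ws i<n

  windows-init : ∀ {OK n s} → Windows OK (suc n) s → Windows OK n s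
  windows-init {n = zero}  _        = tt
  windows-init {n = suc n} (w , ws) = w , windows-init ws

  windows-pad : ∀ {OK x s} n → OK x (s 0) (s 1) → Windows OK n s → Windows OK n (x ∷ˢ s)
  windows-pad zero    _  _ = tt
  windows-pad (suc n) ok w = ok , windows-init w

  constant-windows : ∀ {OK a} → OK a a a → ∀ r → Windows OK r (const a)
  constant-windows ok zero    = tt
  constant-windows ok (suc r) = ok , constant-windows ok r

  subst₃ : ∀ (P : A → A → A → Set) {l l′ c c′ r r′} → l ≡ l′ → c ≡ c′ → r ≡ r′ → P l c r → P l′ c′ r′
  subst₃ P refl refl refl p = p

  restrict : ℕ → A → (ℕ → A) → ℕ → A
  restrict n d s j = if j <ᵇ n then s j else d

  restrict-< : ∀ {n d} s {j} → j < n → restrict n d s j ≡ s j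
  restrict-< s j<n rewrite T⇒≡true (<⇒<ᵇ j<n) = refl

  restrict-≤ : ∀ {n d} s {j} → j ≤ n → s n ≡ d → restrict n d s j ≡ s j
  restrict-≤ {n} s j≤n sn≡d with m≤n⇒m<n∨m≡n j≤n
  ... | inj₁ j<n  = restrict-< s j<n
  ... | inj₂ refl rewrite ¬T⇒≡false (<-irrefl refl ∘ <ᵇ⇒< n n) = sym sn≡d

module _ {n X} (B : PathLike n X) where
  open PathLike B

  Local : {A : Set} → (A → A → A → Set) → (ℕ → A) → Set
  Local OK s = ∀ {i} → i < n → OK (s (prev i)) (s i) (s (next i))

-- On a path the window of column i is the i-th window of the sequence padded by d in front.
path-local : ∀ {A : Set} {OK : A → A → A → Set} {n d s} (0<n : 0 < n) →
             Windows OK n (d ∷ˢ s) → s n ≡ d → Local (path 0<n) OK (restrict n d s)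
path-local {OK = OK} {suc k} {d} {s} _ ws sn≡d i<n =
  subst₃ OK (left i<n) (sym (restrict-≤ s (<⇒≤ i<n) sn≡d)) (sym (restrict-≤ s i<n sn≡d)) (windows-at {s = d ∷ˢ s} ws i<n)
  where
  left : ∀ {i} → i < suc k → (d ∷ˢ s) i ≡ restrict (suc k) d s ((suc k ∷ˢ id) i)
  left {zero}  _   = trans (sym sn≡d) (sym (restrict-≤ s ≤-refl sn≡d))
  left {suc i} i<n = sym (restrict-≤ s (<⇒≤ (<-trans (n<1+n i) i<n)) sn≡d)

-- On a cycle the window of column i is the (i - 1)-th window of a sequence of period n.
cycle-local : ∀ {A : Set} {OK : A → A → A → Set} {n d s} (3≤n : 3 ≤ n) →
              Windows OK n s → s n ≡ s 0 → s (suc n) ≡ s 1 → Local (cycle 3≤n) OK (restrict n d s)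
cycle-local {n = 1} (s≤s ())
cycle-local {n = 2} (s≤s (s≤s ()))
cycle-local {OK = OK} {n@(suc (suc (suc k)))} {d} {s} _ ws sn≡s0 sn+1≡s1 {zero} _ =
  subst₃ OK (sym (restrict-< s (n<1+n _))) (trans sn≡s0 (sym (restrict-< {n = n} {d = d} s z<s)))
             (trans sn+1≡s1 (sym (restrict-< {n = n} {d = d} s (s<s z<s))))
             (windows-at {s = s} ws (n<1+n (suc (suc k))))
cycle-local {OK = OK} {n@(suc (suc (suc k)))} {d} {s} _ ws sn≡s0 sn+1≡s1 {suc i} i<n =
  subst₃ OK (sym (restrict-< s (<-trans (n<1+n i) i<n))) (sym (restrict-< s i<n)) right
             (windows-at {s = s} ws (<-trans (n<1+n i) i<n))
  where
  right : s (suc (suc i)) ≡ restrict n d s (cycleNext n (suc i))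
  right with cycleNext-cases n (suc i)
  ... | inj₁ (≢n , eq)   = trans (sym (restrict-< s (≤∧≢⇒< i<n ≢n))) (cong (restrict n d s) (sym eq))
  ... | inj₂ (refl , eq) = trans (trans sn≡s0 (sym (restrict-< {n = n} {d = d} s z<s))) (cong (restrict n d s) (sym eq))

-- Lower bounds

pick-third : ∀ b c → ∃[ x ] x < 3 × x ≢ b × x ≢ c
pick-third 0             0             = 1 , s<s z<s , (λ ()) , (λ ())
pick-third 0             1             = 2 , ≤-refl , (λ ()) , (λ ())
pick-third 0             (suc (suc _)) = 1 , s<s z<s , (λ ()) , (λ ())
pick-third 1             0             = 2 , ≤-refl , (λ ()) , (λ ())
pick-third 1             (suc _)       = 0 , z<s , (λ ()) , (λ ())
pick-third (suc (suc _)) 0             = 1 , s<s z<s , (λ ()) , (λ ())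
pick-third (suc (suc _)) (suc _)       = 0 , z<s , (λ ()) , (λ ())

module LowerBounds (n m : ℕ) (X : ℕ → ℕ → Bool) where
  open Product n m X

  module _ {F : ℕ → ℕ → Bool} (dom : Dominates F) where
    open Dominator

    two-in-columns : ∀ {p q j b j′ b′} → j ≡ p ⊎ j ≡ q → j′ ≡ p ⊎ j′ ≡ q → b < m → b′ < m → b ≢ b′ →
                     T (F j b) → T (F j′ b′) → 2 ≤ count F p + count F q
    two-in-columns (inj₁ refl) (inj₁ refl) b<m b′<m b≢b′ h h′ = ≤-trans (2≤# _ b<m b′<m b≢b′ h h′) (m≤m+n _ _)
    two-in-columns (inj₂ refl) (inj₂ refl) b<m b′<m b≢b′ h h′ = ≤-trans (2≤# _ b<m b′<m b≢b′ h h′) (m≤n+m _ _)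
    two-in-columns (inj₁ refl) (inj₂ refl) b<m b′<m _ h h′ = +-mono-≤ (1≤# _ b<m h) (1≤# _ b′<m h′)
    two-in-columns {p} {q} (inj₂ refl) (inj₁ refl) b<m b′<m _ h h′ =
      subst (2 ≤_) (+-comm (count F q) (count F p)) (+-mono-≤ (1≤# (F q) b<m h) (1≤# (F p) b′<m h′))

    dominator-in-columns : ∀ {i p q x} → (∀ {j} → j < n → T (X j i) → j ≡ p ⊎ j ≡ q) → Dominator F i x →
                           1 ≤ count F p + count F q
    dominator-in-columns nbrs d with nbrs (col<n d) (adjacent d)
    ... | inj₁ refl = ≤-trans (1≤# _ (lab<m d) (held d)) (m≤m+n _ _)
    ... | inj₂ refl = ≤-trans (1≤# _ (lab<m d) (held d)) (m≤n+m _ _)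

    -- Either column i holds a vertex (i , a) and the vertex (i , x) with x ≢ a needs a dominator,
    -- or (i , 0) and (i , b) need dominators, with different labels b ≢ 0 and b′ ≢ b.
    window-≥2 : ∀ {i p q} → 2 ≤ m → i < n → (∀ {j} → j < n → T (X j i) → j ≡ p ⊎ j ≡ q) →
                2 ≤ count F i + (count F p + count F q)
    window-≥2 {i} {p} {q} 2≤m i<n nbrs with T? (F i 0) | T? (F i 1)
    ... | yes h₀ | yes h₁ = ≤-trans (2≤# _ (<-trans z<s 2≤m) 2≤m (λ ()) h₀ h₁) (m≤m+n _ _)
    ... | yes h₀ | no ¬h₁ = +-mono-≤ (1≤# _ (<-trans z<s 2≤m) h₀) (dominator-in-columns nbrs (dom i<n 2≤m ¬h₁))
    ... | no ¬h₀ | _ with d ← dom i<n (<-trans z<s 2≤m) ¬h₀ with T? (F i (lab d))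
    ...   | yes h = +-mono-≤ (1≤# _ (lab<m d) h) (dominator-in-columns nbrs d)
    ...   | no ¬h with d′ ← dom i<n (lab<m d) ¬h =
      ≤-trans (two-in-columns (nbrs (col<n d) (adjacent d)) (nbrs (col<n d′) (adjacent d′)) (lab<m d) (lab<m d′)
                              (≢-sym (lab≢ d′)) (held d) (held d′))
              (m≤n+m _ (count F i))

    -- (i , 0) and (i , b) are dominated from column p with labels b ≢ 0 and b′ ≢ b; a third
    -- label x of column p is either used by D or (p , x) is dominated from column q.
    end-≥3 : ∀ {i p q} → 3 ≤ m → i < n → (∀ {j} → j < n → T (X j i) → j ≡ p) →
             (∀ {j} → j < n → T (X j p) → j ≡ i ⊎ j ≡ q) → count F i ≡ 0 → 3 ≤ count F p + count F q
    end-≥3 {i} {p} {q} 3≤m i<n only-p nbrs-p empty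
      with d ← dom i<n (<-≤-trans z<s 3≤m) (#≡0⇒¬T (F i) empty (<-≤-trans z<s 3≤m))
      with refl ← only-p (col<n d) (adjacent d)
      with d′ ← dom i<n (lab<m d) (#≡0⇒¬T (F i) empty (lab<m d))
      with refl ← only-p (col<n d′) (adjacent d′)
      with x , x<3 , x≢b , x≢b′ ← pick-third (lab d) (lab d′)
      with T? (F p x)
    ... | yes h = ≤-trans (length≤# (F p) ((≢-sym (lab≢ d′) ∷ ≢-sym x≢b ∷ []) ∷ (≢-sym x≢b′ ∷ []) ∷ [] ∷ [])
                                      ((lab<m d , held d) ∷ (lab<m d′ , held d′) ∷ (<-≤-trans x<3 3≤m , h) ∷ []))
                          (m≤m+n _ _)
    ... | no ¬h with d″ ← dom (col<n d) (<-≤-trans x<3 3≤m) ¬h with nbrs-p (col<n d″) (adjacent d″)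
    ...   | inj₁ refl = ⊥-elim (#≡0⇒¬T (F i) empty (lab<m d″) (held d″))
    ...   | inj₂ refl = +-mono-≤ (2≤# _ (lab<m d) (lab<m d′) (≢-sym (lab≢ d′)) (held d) (held d′)) (1≤# _ (lab<m d″) (held d″))

    layer-window : ∀ {i p q} (ℓ : ℕ → ℕ) → i < n → ℓ i < m →
                   (∀ {j b} → j < n → T (X j i) → b < m → b ≢ ℓ i → b ≡ ℓ j) →
                   (∀ {j} → j < n → T (X j i) → j ≡ p ⊎ j ≡ q) →
                   1 ≤ [ F i (ℓ i) ]ᵇ + ([ F p (ℓ p) ]ᵇ + [ F q (ℓ q) ]ᵇ)
    layer-window {i} {p} {q} ℓ i<n ℓi<m alternate nbrs with T? (F i (ℓ i))
    ... | yes h = ≤-trans (≤-reflexive (sym (T⇒[]ᵇ≡1 h))) (m≤m+n _ _)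
    ... | no ¬h
      with d ← dom i<n ℓi<m ¬h
      with held′ ← subst (T ∘ F (col d)) (alternate (col<n d) (adjacent d) (lab<m d) (lab≢ d)) (held d)
      with nbrs (col<n d) (adjacent d)
    ... | inj₁ refl = ≤-trans (≤-reflexive (sym (T⇒[]ᵇ≡1 held′))) (≤-trans (m≤m+n _ [ F q (ℓ q) ]ᵇ) (m≤n+m _ [ F i (ℓ i) ]ᵇ))
    ... | inj₂ refl = ≤-trans (≤-reflexive (sym (T⇒[]ᵇ≡1 held′))) (≤-trans (m≤n+m _ [ F p (ℓ p) ]ᵇ) (m≤n+m _ [ F i (ℓ i) ]ᵇ))

module _ {n X} (B : PathLike n X) where
  open PathLike B

  window : (ℕ → ℕ) → ℕ → ℕ
  window c i = c i + (c (prev i) + c (next i))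

  degree≤2 : ∀ {i} → i < n → #[ j < n ] X j i ≤ 2
  degree≤2 {i} i<n = begin
    #[ j < n ] X j i                                      ≤⟨ ∑-mono-≤ n (λ j<n → pointwise j<n) ⟩
    ∑[ j < n ] ([ j ≡ᵇ prev i ]ᵇ + [ j ≡ᵇ next i ]ᵇ)       ≡⟨ ∑-distrib-+ n _ _ ⟩
    #[ j < n ] (j ≡ᵇ prev i) + #[ j < n ] (j ≡ᵇ next i)   ≤⟨ +-mono-≤ (at-most-one (prev i)) (at-most-one (next i)) ⟩
    2                                                     ∎
    where
    open ≤-Reasoning
    pointwise : ∀ {j} → j < n → [ X j i ]ᵇ ≤ [ j ≡ᵇ prev i ]ᵇ + [ j ≡ᵇ next i ]ᵇ
    pointwise {j} j<n with T? (X j i)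
    ... | no ¬x = ≤-trans (≤-reflexive (cong [_]ᵇ (¬T⇒≡false ¬x))) z≤n
    ... | yes x with nbr⇒ i<n j<n x
    ...   | inj₁ refl = ≤-trans (≤-reflexive (T⇒[]ᵇ≡1 x)) (≤-trans (≤-reflexive (sym (T⇒[]ᵇ≡1 (≡⇒≡ᵇ j j refl)))) (m≤m+n _ _))
    ...   | inj₂ refl = ≤-trans (≤-reflexive (T⇒[]ᵇ≡1 x)) (≤-trans (≤-reflexive (sym (T⇒[]ᵇ≡1 (≡⇒≡ᵇ j j refl)))) (m≤n+m _ _))
    at-most-one : ∀ p → #[ j < n ] (j ≡ᵇ p) ≤ 1
    at-most-one p = #≤1 n _ (λ {b} {c} _ _ b≡p c≡p → trans (≡ᵇ⇒≡ b p b≡p) (sym (≡ᵇ⇒≡ c p c≡p)))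

-- Every column is the centre of one window and a neighbour in two more.
∑-window≤ : ∀ {n X} (B : PathLike n X) (c : ℕ → ℕ) → c n ≡ 0 → ∑ n (window B c) ≤ 3 * ∑ n c
∑-window≤ {zero}  B c _   = z≤n
∑-window≤ {suc k} B c c≡0 = begin
  ∑ n (window B c)                          ≡⟨ trans (∑-distrib-+ n c (λ i → c (prev i) + c (next i)))
                                                     (cong (∑ n c +_) (∑-distrib-+ n (c ∘ prev) (c ∘ next))) ⟩
  ∑ n c + (∑ n (c ∘ prev) + ∑ n (c ∘ next)) ≤⟨ +-monoʳ-≤ (∑ n c) (+-mono-≤ prev≤ next≤) ⟩
  ∑ n c + (∑ n c + ∑ n c)                   ≡⟨ cong (λ s → ∑ n c + (∑ n c + s)) (+-identityʳ _) ⟨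
  3 * ∑ n c                                 ∎
  where
  open ≤-Reasoning
  open PathLike B
  n : ℕ
  n = suc k
  prev≤ : ∑ n (c ∘ prev) ≤ ∑ n c
  prev≤ = +-cancelʳ-≤ (c k) _ _ (begin
    ∑ n (c ∘ prev) + c k  ≡⟨ ∑-shiftʳ k c prev (prev-suc ∘ s<s) ⟩
    c (prev 0) + ∑ n c    ≤⟨ +-monoˡ-≤ (∑ n c) first≤ ⟩
    c k + ∑ n c           ≡⟨ +-comm (c k) _ ⟩
    ∑ n c + c k           ∎)
    where
    first≤ : c (prev 0) ≤ c k
    first≤ = [ (λ eq → ≤-reflexive (cong c eq)) , (λ eq → ≤-trans (≤-reflexive (trans (cong c eq) c≡0)) z≤n) ]′ prev-first
  next≤ : ∑ n (c ∘ next) ≤ ∑ n c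
  next≤ = +-cancelʳ-≤ (c 0) _ _ (begin
    ∑ n (c ∘ next) + c 0  ≡⟨ ∑-shiftˡ k c next (next-suc ∘ s<s) ⟩
    ∑ n c + c (next k)    ≤⟨ +-monoʳ-≤ (∑ n c) last≤ ⟩
    ∑ n c + c 0           ∎)
    where
    last≤ : c (next k) ≤ c 0
    last≤ = [ (λ eq → ≤-reflexive (cong c eq)) , (λ eq → ≤-trans (≤-reflexive (trans (cong c eq) c≡0)) z≤n) ]′ next-last

windows-lower-bound : ∀ {n X} (B : PathLike n X) (c : ℕ → ℕ) {k} → c n ≡ 0 →
                      (∀ {i} → i < n → k ≤ window B c i) → n * k ≤ 3 * ∑ n c
windows-lower-bound {n} B c c≡0 bound = ≤-trans (*≤∑ n (window B c) bound) (∑-window≤ B c c≡0)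

3*≤3*+2⇒≤ : ∀ {k s} → 3 * k ≤ 3 * s + 2 → k ≤ s
3*≤3*+2⇒≤ {k} {s} h = m<1+n⇒m≤n (*-cancelˡ-< 3 k (suc s) (begin-strict
  3 * k       ≤⟨ h ⟩
  3 * s + 2   <⟨ +-monoʳ-< (3 * s) (n<1+n 2) ⟩
  3 * s + 3   ≡⟨ +-comm (3 * s) 3 ⟩
  3 + 3 * s   ≡⟨ *-suc 3 s ⟨
  3 * suc s   ∎))
  where open ≤-Reasoning

module _ {n X} (B : PathLike n X) (m : ℕ) where
  open PathLike B
  open Product n m X
  open LowerBounds n m X

  pathLike-lower-bound : 2 ≤ m → ∀ {k} → 3 * k ≤ n * 2 + 2 → LowerBound G k
  pathLike-lower-bound 2≤m {k} bound D dom = 3*≤3*+2⇒≤ (≤-trans bound (+-monoˡ-≤ 2 (begin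
    n * 2                           ≤⟨ windows-lower-bound B (count (toColumns D)) (count-toColumns-n D)
                                         (λ i<n → window-≥2 (toColumns-dominates dom) 2≤m i<n (nbr⇒ i<n)) ⟩
    3 * ∑ n (count (toColumns D))   ≡⟨ cong (3 *_) (∣∣≡size-toColumns D) ⟨
    3 * ∣ D ∣                       ∎)))
    where open ≤-Reasoning

parity : ℕ → ℕ
parity zero          = 0
parity (suc zero)    = 1
parity (suc (suc k)) = parity k

parity<2 : ∀ k → parity k < 2
parity<2 zero          = z<s
parity<2 (suc zero)    = s<s z<s
parity<2 (suc (suc k)) = parity<2 k

parity-suc : ∀ k → parity (suc k) ≡ 1 ∸ parity k
parity-suc zero          = refl
parity-suc (suc zero)    = refl
parity-suc (suc (suc k)) = parity-suc k

parity-≢ : ∀ k → parity k ≢ parity (suc k)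
parity-≢ zero          ()
parity-≢ (suc zero)    ()
parity-≢ (suc (suc k)) = parity-≢ k

parity-other : ∀ {b} k → b < 2 → b ≢ parity k → b ≡ parity (suc k)
parity-other {0}           zero          _ b≢ = ⊥-elim (b≢ refl)
parity-other {1}           zero          _ _  = refl
parity-other {0}           (suc zero)    _ _  = refl
parity-other {1}           (suc zero)    _ b≢ = ⊥-elim (b≢ refl)
parity-other {suc (suc _)} _             (s<s (s<s ()))
parity-other               (suc (suc k)) b<2 b≢ = parity-other k b<2 b≢

#<2≡parity+parity : ∀ (f : ℕ → Bool) k → #[ b < 2 ] f b ≡ [ f (parity k) ]ᵇ + [ f (parity (suc k)) ]ᵇ
#<2≡parity+parity f zero          = cong ([ f 0 ]ᵇ +_) (+-identityʳ _)
#<2≡parity+parity f (suc zero)    = trans (cong ([ f 0 ]ᵇ +_) (+-identityʳ _)) (+-comm [ f 0 ]ᵇ _)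
#<2≡parity+parity f (suc (suc k)) = #<2≡parity+parity f k

-- If neighbours have opposite parity, G × K₂ is the disjoint union of the two copies
-- {(j , parity j)} and {(j , parity (1 + j))} of G, and each copy needs ⌈n/3⌉ vertices.
module _ {n X} (B : PathLike n X) (opposite : ∀ {i j} → i < n → j < n → T (X j i) → parity j ≡ parity (suc i)) where
  open PathLike B
  open Product n 2 X
  open LowerBounds n 2 X

  layer-≥ : ∀ {F} → Dominates F → (∀ {b} → ¬ T (F n b)) → ∀ (ℓ : ℕ → ℕ) → (∀ j → ℓ j < 2) →
            (∀ {i j b} → i < n → j < n → T (X j i) → b < 2 → b ≢ ℓ i → b ≡ ℓ j) →
            n ≤ 3 * ∑[ j < n ] [ F j (ℓ j) ]ᵇ
  layer-≥ {F} dom absent ℓ ℓ<2 alternate = subst (_≤ 3 * ∑[ j < n ] [ F j (ℓ j) ]ᵇ) (*-identityʳ n)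
    (windows-lower-bound B (λ j → [ F j (ℓ j) ]ᵇ) (cong [_]ᵇ (¬T⇒≡false absent))
      (λ i<n → layer-window dom ℓ i<n (ℓ<2 _) (alternate i<n) (nbr⇒ i<n)))

  two-layer-lower-bound : ∀ {k} → 3 * k ≤ n + 2 → LowerBound G (k + k)
  two-layer-lower-bound {k} bound D dom = begin
    k + k                                 ≤⟨ +-mono-≤ (3*≤3*+2⇒≤ {k} {∑ n E₀} (≤-trans bound (+-monoˡ-≤ 2 even-layer)))
                                                      (3*≤3*+2⇒≤ {k} {∑ n E₁} (≤-trans bound (+-monoˡ-≤ 2 odd-layer))) ⟩
    ∑[ j < n ] E₀ j + ∑[ j < n ] E₁ j     ≡⟨ ∑-distrib-+ n E₀ E₁ ⟨
    ∑[ j < n ] (E₀ j + E₁ j)              ≡⟨ ∑-cong n (λ {j} _ → #<2≡parity+parity (F j) j) ⟨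
    size F                                ≡⟨ ∣∣≡size-toColumns D ⟨
    ∣ D ∣                                 ∎
    where
    open ≤-Reasoning
    F : ℕ → ℕ → Bool
    F = toColumns D
    E₀ E₁ : ℕ → ℕ
    E₀ j = [ F j (parity j) ]ᵇ
    E₁ j = [ F j (parity (suc j)) ]ᵇ
    absent : ∀ {b} → ¬ T (F n b)
    absent h = <-irrefl refl (toColumns-col< D h)
    even-layer : n ≤ 3 * ∑ n E₀
    even-layer = layer-≥ (toColumns-dominates dom) absent parity parity<2
      (λ {i} i<n j<n x b<2 b≢ → trans (parity-other i b<2 b≢) (sym (opposite i<n j<n x)))
    odd-layer : n ≤ 3 * ∑ n E₁
    odd-layer = layer-≥ (toColumns-dominates dom) absent (parity ∘ suc) (parity<2 ∘ suc)
      (λ {i} {j} i<n j<n x b<2 b≢ → trans (parity-other (suc i) b<2 b≢)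
        (sym (trans (parity-suc j) (trans (cong (1 ∸_) (opposite i<n j<n x)) (sym (parity-suc (suc i)))))))

-- On a path the two end columns are counted only twice by the windows.
path-window-sum : ∀ k (c : ℕ → ℕ) → c (suc k) ≡ 0 → ∑ (suc k) (window (path z<s) c) + (c k + c 0) ≡ 3 * ∑ (suc k) c
path-window-sum k c c≡0 = begin
  ∑ n (window (path z<s) c) + (c k + c 0)                  ≡⟨ cong (_+ (c k + c 0)) (trans (∑-distrib-+ n c (λ i → c (prev i) + c (suc i)))
                                                                 (cong (∑ n c +_) (∑-distrib-+ n (c ∘ prev) (c ∘ suc)))) ⟩
  ∑ n c + (∑ n (c ∘ prev) + ∑ n (c ∘ suc)) + (c k + c 0)   ≡⟨ rearrange (∑ n c) (∑ n (c ∘ prev)) (∑ n (c ∘ suc)) (c k) (c 0) ⟩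
  ∑ n c + ((∑ n (c ∘ prev) + c k) + (∑ n (c ∘ suc) + c 0)) ≡⟨ cong₂ (λ a b → ∑ n c + (a + b)) prev-sum next-sum ⟩
  ∑ n c + (∑ n c + ∑ n c)                                  ≡⟨ cong (λ s → ∑ n c + (∑ n c + s)) (+-identityʳ _) ⟨
  3 * ∑ n c                                                ∎
  where
  open ≡-Reasoning
  n : ℕ
  n = suc k
  prev : ℕ → ℕ
  prev = suc k ∷ˢ id
  rearrange : ∀ a b c d e → a + (b + c) + (d + e) ≡ a + ((b + d) + (c + e))
  rearrange = solve-∀
  prev-sum : ∑ n (c ∘ prev) + c k ≡ ∑ n c
  prev-sum = trans (∑-shiftʳ k c prev (λ _ → refl)) (cong (_+ ∑ n c) c≡0)
  next-sum : ∑ n (c ∘ suc) + c 0 ≡ ∑ n c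
  next-sum = trans (∑-shiftˡ k c suc (λ _ → refl)) (trans (cong (∑ n c +_) c≡0) (+-identityʳ _))

path-window-sum-≥ : ∀ k (w c : ℕ → ℕ) → (∀ {i} → i < 4 + k → 2 ≤ w i) → 3 ≤ c 0 + w 1 →
                    3 ≤ c (3 + k) + w (2 + k) → (4 + k) * 2 + 2 ≤ ∑ (4 + k) w + (c (3 + k) + c 0)
path-window-sum-≥ k w c w≥2 left right = begin
  (4 + k) * 2 + 2                                              ≡⟨ shape k ⟩
  2 + (3 + (k * 2 + (3 + 2)))                                  ≤⟨ +-mono-≤ (w≥2 z<s) (+-mono-≤ left (+-mono-≤ middle
                                                                    (+-mono-≤ right (w≥2 (n<1+n (3 + k)))))) ⟩
  w 0 + ((c 0 + w 1) + (G + ((c (3 + k) + g k) + g (suc k))))  ≡⟨ rearrange (w 0) (w 1) G (g k) (g (suc k)) (c (3 + k)) (c 0) ⟩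
  w 0 + (w 1 + ((G + g k) + g (suc k))) + (c (3 + k) + c 0)    ≡⟨ cong (λ s → w 0 + (w 1 + s) + (c (3 + k) + c 0))
                                                                    (trans (∑-last (suc k) g) (cong (_+ g (suc k)) (∑-last k g))) ⟨
  ∑ (4 + k) w + (c (3 + k) + c 0)                              ∎
  where
  open ≤-Reasoning
  g : ℕ → ℕ
  g i = w (2 + i)
  G : ℕ
  G = ∑ k g
  middle : k * 2 ≤ G
  middle = *≤∑ k g (λ i<k → w≥2 (s<s (s<s (<-trans i<k (<-trans (n<1+n k) (n<1+n (suc k)))))))
  shape : ∀ k → (4 + k) * 2 + 2 ≡ 2 + (3 + (k * 2 + (3 + 2)))
  shape = solve-∀
  rearrange : ∀ w₀ w₁ G a b cₗ c₀ → w₀ + ((c₀ + w₁) + (G + ((cₗ + a) + b))) ≡ w₀ + (w₁ + ((G + a) + b)) + (cₗ + c₀)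
  rearrange = solve-∀

end-bonus : ∀ {a W} → (a ≡ 0 → 3 ≤ W) → 2 ≤ W → 3 ≤ a + W
end-bonus {zero}  W≥3 _   = W≥3 refl
end-bonus {suc a} _   W≥2 = s≤s (≤-trans W≥2 (m≤n+m _ a))

path-lower-bound : ∀ {n m} → 3 ≤ m → 4 ≤ n → ∀ {k} → 3 * k ≤ n * 2 + 4 → LowerBound (Product.G n m pathᵇ) k
path-lower-bound {1} _ (s≤s ())
path-lower-bound {2} _ (s≤s (s≤s ()))
path-lower-bound {3} _ (s≤s (s≤s (s≤s ())))
path-lower-bound {n@(suc (suc (suc (suc k′))))} {m} 3≤m _ {k} bound D dom = 3*≤3*+2⇒≤ (≤-trans bound (begin
  n * 2 + 4                            ≡⟨ +-assoc (n * 2) 2 2 ⟨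
  n * 2 + 2 + 2                        ≤⟨ +-monoˡ-≤ 2 (path-window-sum-≥ k′ w c w≥2 left right) ⟩
  ∑ n w + (c (3 + k′) + c 0) + 2       ≡⟨ cong (_+ 2) (path-window-sum (3 + k′) c (count-toColumns-n D)) ⟩
  3 * ∑ n c + 2                        ≡⟨ cong (λ s → 3 * s + 2) (∣∣≡size-toColumns D) ⟨
  3 * ∣ D ∣ + 2                        ∎))
  where
  open ≤-Reasoning
  open Product n m pathᵇ
  open LowerBounds n m pathᵇ
  B : PathLike n pathᵇ
  B = path z<s
  open PathLike B
  dom′ : Dominates (toColumns D)
  dom′ = toColumns-dominates dom
  c w : ℕ → ℕ
  c = count (toColumns D)
  w = window B c
  w≥2 : ∀ {i} → i < n → 2 ≤ w i
  w≥2 i<n = window-≥2 dom′ (≤-trans (n≤1+n 2) 3≤m) i<n (nbr⇒ i<n)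
  left : 3 ≤ c 0 + w 1
  left = end-bonus (λ c₀≡0 → subst (λ a → 3 ≤ c 1 + (a + c 2)) (sym c₀≡0)
                     (end-≥3 dom′ 3≤m z<s only-1 (nbr⇒ (s<s z<s)) c₀≡0)) (w≥2 (s<s z<s))
    where
    only-1 : ∀ {j} → j < n → T (pathᵇ j 0) → j ≡ 1
    only-1 j<n x with nbr⇒ z<s j<n x
    ... | inj₁ refl = ⊥-elim (<-irrefl refl j<n)
    ... | inj₂ eq   = eq
  right : 3 ≤ c (3 + k′) + w (2 + k′)
  right = end-bonus (λ cₗ≡0 → subst (λ a → 3 ≤ c (2 + k′) + (c (1 + k′) + a)) (sym cₗ≡0)
                      (subst (3 ≤_) (cong (c (2 + k′) +_) (sym (+-identityʳ _)))
                        (end-≥3 dom′ 3≤m ≤-refl only-prev nbrs-prev cₗ≡0))) (w≥2 (n≤1+n (3 + k′)))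
    where
    only-prev : ∀ {j} → j < n → T (pathᵇ j (3 + k′)) → j ≡ 2 + k′
    only-prev j<n x with nbr⇒ ≤-refl j<n x
    ... | inj₁ eq   = eq
    ... | inj₂ refl = ⊥-elim (<-irrefl refl j<n)
    nbrs-prev : ∀ {j} → j < n → T (pathᵇ j (2 + k′)) → j ≡ 3 + k′ ⊎ j ≡ 1 + k′
    nbrs-prev j<n x with nbr⇒ (n≤1+n (3 + k′)) j<n x
    ... | inj₁ eq = inj₂ eq
    ... | inj₂ eq = inj₁ eq

-- Constructions

-- A column holds the single vertex with the given label, or nothing.
data LabelWindow : Maybe ℕ → Maybe ℕ → Maybe ℕ → Set where
  start  : ∀ {a} → LabelWindow nothing (just a) (just a)
  middle : ∀ {a} → LabelWindow (just a) (just a) (just a)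
  end    : ∀ {a} → LabelWindow (just a) (just a) nothing
  gap    : ∀ {a b} → a ≢ b → LabelWindow (just a) nothing (just b)

holds : Maybe ℕ → ℕ → Bool
holds (just a) b = a ≡ᵇ b
holds nothing  _ = false

holds⇒ : ∀ c {b} → T (holds c b) → c ≡ just b
holds⇒ (just a) h = cong just (≡ᵇ⇒≡ _ _ h)

holds-just : ∀ a → T (holds (just a) a)
holds-just a = ≡⇒≡ᵇ a a refl

module _ {n X} (B : PathLike n X) where
  open PathLike B

  module SingleLabel (m : ℕ) (s : ℕ → Maybe ℕ) (label< : ∀ j {a} → s j ≡ just a → a < m)
                     (ok : Local B LabelWindow (restrict n nothing s)) where
    open Product n m X

    col : ℕ → Maybe ℕ
    col = restrict n nothing s

    labelled : ℕ → ℕ → Bool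
    labelled j = holds (col j)

    col-just : ∀ {j a} → col j ≡ just a → j < n × a < m
    col-just {j} eq with j <ᵇ n in lt
    ... | true = <ᵇ⇒< j n (≡true⇒T lt) , label< j eq

    held-at : ∀ {j a} → col j ≡ just a → T (labelled j a)
    held-at {a = a} eq = subst (λ c → T (holds c a)) (sym eq) (holds-just a)

    via-prev : ∀ {i x a} → i < n → col (prev i) ≡ just a → a ≢ x → Dominator labelled i x
    via-prev i<n eq a≢x = dominator _ _ (proj₁ (col-just eq)) (proj₂ (col-just eq))
      (held-at eq) (prev-adj i<n (proj₁ (col-just eq))) a≢x

    via-next : ∀ {i x a} → i < n → col (next i) ≡ just a → a ≢ x → Dominator labelled i x
    via-next i<n eq a≢x = dominator _ _ (proj₁ (col-just eq)) (proj₂ (col-just eq))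
      (held-at eq) (next-adj i<n (proj₁ (col-just eq))) a≢x

    dominates : Dominates labelled
    dominates {i} {x} i<n _ ¬held = go (ok i<n) refl refl refl
      where
      label≢ : ∀ {a} → col i ≡ just a → a ≢ x
      label≢ eq refl = ¬held (held-at eq)
      go : ∀ {l c r} → LabelWindow l c r → col (prev i) ≡ l → col i ≡ c → col (next i) ≡ r → Dominator labelled i x
      go start         _   eqc eqr = via-next i<n eqr (label≢ eqc)
      go middle        eql eqc _   = via-prev i<n eql (label≢ eqc)
      go end           eql eqc _   = via-prev i<n eql (label≢ eqc)
      go (gap {a} a≢b) eql _   eqr with a ≟ x
      ... | yes refl = via-next i<n eqr (a≢b ∘ sym)
      ... | no  a≢x  = via-prev i<n eql a≢x

    independent : Independent labelled
    independent {i} {a} {j} {b} ha hb x = go (ok j<n) refl refl refl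
      where
      i<n : i < n
      i<n = proj₁ (col-just (holds⇒ (col i) ha))
      j<n : j < n
      j<n = proj₁ (col-just (holds⇒ (col j) hb))
      label-b : ∀ {c} → col j ≡ c → c ≡ just b
      label-b eqc = trans (sym eqc) (holds⇒ (col j) hb)
      side : ∀ {l r} → col (prev j) ≡ l → col (next j) ≡ r → l ≡ just a ⊎ r ≡ just a
      side eql eqr with nbr⇒ j<n i<n x
      ... | inj₁ refl = inj₁ (trans (sym eql) (holds⇒ (col i) ha))
      ... | inj₂ refl = inj₂ (trans (sym eqr) (holds⇒ (col i) ha))
      go : ∀ {l c r} → LabelWindow l c r → col (prev j) ≡ l → col j ≡ c → col (next j) ≡ r → a ≡ b
      go start  eql eqc eqr with side eql eqr
      ... | inj₂ eq = trans (just-injective (sym eq)) (just-injective (label-b eqc))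
      go middle eql eqc eqr with side eql eqr
      ... | inj₁ eq = trans (just-injective (sym eq)) (just-injective (label-b eqc))
      ... | inj₂ eq = trans (just-injective (sym eq)) (just-injective (label-b eqc))
      go end    eql eqc eqr with side eql eqr
      ... | inj₁ eq = trans (just-injective (sym eq)) (just-injective (label-b eqc))
      go (gap _) _ eqc _ with () ← label-b eqc

    one-per-column : OnePerColumn labelled
    one-per-column {j} _ hb hc _ _ = just-injective (trans (sym (holds⇒ (col j) hb)) (holds⇒ (col j) hc))

    construction : Construction (#[ j < n ] is-just (s j))
    construction = record
      { set = labelled ; dominates = dominates ; independent = independent
      ; one-per-column = one-per-column ; size≡ = ∑-cong n column }
      where
      column : ∀ {j} → j < n → #[ b < m ] holds (col j) b ≡ [ is-just (s j) ]ᵇ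
      column {j} j<n with s j in eq | restrict-< {d = nothing} s j<n
      ... | just a  | eqc rewrite eqc = #-≡ᵇ (label< j eq)
      ... | nothing | eqc rewrite eqc = #≡0 m _ (λ _ ())

-- A column is in S, and then holds both of its vertices, or not.
data CoverWindow : Bool → Bool → Bool → Set where
  isolated : CoverWindow false true false
  coveredˡ : ∀ {r} → CoverWindow true false r
  coveredʳ : ∀ {l} → CoverWindow l false true

other-label : ∀ {x} → x < 2 → 1 ∸ x < 2 × 1 ∸ x ≢ x
other-label {0} _ = s<s z<s , λ ()
other-label {1} _ = z<s , λ ()
other-label {suc (suc _)} (s<s (s<s ()))

same-label : ∀ {x b c} → x < 2 → b < 2 → c < 2 → b ≢ x → c ≢ x → b ≡ c
same-label {0} {0}           _ _ _ b≢ _ = ⊥-elim (b≢ refl)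
same-label {0} {1} {0}       _ _ _ _ c≢ = ⊥-elim (c≢ refl)
same-label {0} {1} {1}       _ _ _ _ _  = refl
same-label {1} {0} {0}       _ _ _ _ _  = refl
same-label {1} {0} {1}       _ _ _ _ c≢ = ⊥-elim (c≢ refl)
same-label {1} {1}           _ _ _ b≢ _ = ⊥-elim (b≢ refl)
same-label {suc (suc _)} (s<s (s<s ()))
same-label {_} {suc (suc _)} _ (s<s (s<s ()))
same-label {_} {_} {suc (suc _)} _ _ (s<s (s<s ()))

module _ {n X} (B : PathLike n X) where
  open PathLike B
  open Product n 2 X

  module Doubled (S : ℕ → Bool) (ok : Local B CoverWindow (restrict n false S)) where

    col : ℕ → Bool
    col = restrict n false S

    doubled : ℕ → ℕ → Bool
    doubled j b = col j ∧ (b <ᵇ 2)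

    col-true : ∀ {j} → col j ≡ true → j < n
    col-true {j} eq with j <ᵇ n in lt
    ... | true = <ᵇ⇒< j n (≡true⇒T lt)

    held-at : ∀ {j b} → col j ≡ true → b < 2 → T (doubled j b)
    held-at eq b<2 = T-∧-intro (≡true⇒T eq) (<⇒<ᵇ b<2)

    held-col : ∀ {j} b → T (doubled j b) → col j ≡ true
    held-col _ h = T⇒≡true (proj₁ (T-∧-elim h))

    dominates : Dominates doubled
    dominates {i} {x} i<n x<2 ¬held = go (ok i<n) refl refl refl
      where
      other : 1 ∸ x < 2 × 1 ∸ x ≢ x
      other = other-label x<2
      go : ∀ {l c r} → CoverWindow l c r → col (prev i) ≡ l → col i ≡ c → col (next i) ≡ r → Dominator doubled i x
      go isolated _ eqc _ = ⊥-elim (¬held (held-at eqc x<2))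
      go coveredˡ eql _ _ = dominator _ _ (col-true eql) (proj₁ other) (held-at eql (proj₁ other))
                                      (prev-adj i<n (col-true eql)) (proj₂ other)
      go coveredʳ _ _ eqr = dominator _ _ (col-true eqr) (proj₁ other) (held-at eqr (proj₁ other))
                                      (next-adj i<n (col-true eqr)) (proj₂ other)

    independent : Independent doubled
    independent {i} {a} {j} {b} ha hb x = ⊥-elim (go (ok j<n) refl refl refl)
      where
      j<n : j < n
      j<n = col-true (held-col b hb)
      go : ∀ {l c r} → CoverWindow l c r → col (prev j) ≡ l → col j ≡ c → col (next j) ≡ r → ⊥
      go isolated eql _ eqr with nbr⇒ j<n (col-true (held-col a ha)) x
      ... | inj₁ refl = case trans (sym eql) (held-col a ha) of λ ()
      ... | inj₂ refl = case trans (sym eqr) (held-col a ha) of λ ()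
      go coveredˡ _ eqc _ = case trans (sym eqc) (held-col b hb) of λ ()
      go coveredʳ _ eqc _ = case trans (sym eqc) (held-col b hb) of λ ()

    one-per-column : OnePerColumn doubled
    one-per-column x<2 hb hc =
      same-label x<2 (<ᵇ⇒< _ 2 (proj₂ (T-∧-elim hb))) (<ᵇ⇒< _ 2 (proj₂ (T-∧-elim hc)))

    construction : Construction (#[ j < n ] S j + #[ j < n ] S j)
    construction = record
      { set = doubled ; dominates = dominates ; independent = independent
      ; one-per-column = one-per-column ; size≡ = trans (∑-cong n column) (∑-distrib-+ n _ _) }
      where
      column : ∀ {j} → j < n → #[ b < 2 ] doubled j b ≡ [ S j ]ᵇ + [ S j ]ᵇ
      column {j} j<n rewrite restrict-< {d = false} S j<n with S j
      ... | true  = refl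
      ... | false = refl

labelBlocks : ℕ → (ℕ → ℕ) → (ℕ → Maybe ℕ) → ℕ → Maybe ℕ
labelBlocks zero    L t = t
labelBlocks (suc Q) L t = just (L 0) ∷ˢ just (L 0) ∷ˢ nothing ∷ˢ labelBlocks Q (L ∘ suc) t

labelBlocks-tail : ∀ Q {L t} j → labelBlocks Q L t (Q * 3 + j) ≡ t j
labelBlocks-tail zero    j = refl
labelBlocks-tail (suc Q) j = labelBlocks-tail Q j

labelBlocks-labels : ∀ Q {L t m} → (∀ k → L k < m) → (∀ j {a} → t j ≡ just a → a < m) →
                     ∀ j {a} → labelBlocks Q L t j ≡ just a → a < m
labelBlocks-labels zero    L<m t<m j                   eq   = t<m j eq
labelBlocks-labels (suc Q) L<m t<m 0                   refl = L<m 0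
labelBlocks-labels (suc Q) L<m t<m 1                   refl = L<m 0
labelBlocks-labels (suc Q) L<m t<m (suc (suc (suc j))) eq   = labelBlocks-labels Q (L<m ∘ suc) t<m j eq

labelBlocks-count : ∀ Q {L t} r → #[ j < Q * 3 + r ] is-just (labelBlocks Q L t j) ≡ Q * 2 + #[ j < r ] is-just (t j)
labelBlocks-count zero    r = refl
labelBlocks-count (suc Q) r = cong (2 +_) (labelBlocks-count Q r)

labelBlocks-windows : ∀ Q {L t e r} → (∀ {k} → suc k < Q → L k ≢ L (suc k)) → (∀ {k} → suc k ≡ Q → L k ≢ e) →
                      t 0 ≡ just e → t 1 ≡ just e → Windows LabelWindow r t →
                      Windows LabelWindow (Q * 3 + r) (labelBlocks Q L t)
labelBlocks-windows zero          _     _  _  _  w = w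
labelBlocks-windows (suc zero)    _     ≢e t₀ t₁ w =
  end , subst (LabelWindow _ nothing) (sym t₀) (gap (≢e refl)) , subst₂ (LabelWindow nothing) (sym t₀) (sym t₁) start , w
labelBlocks-windows (suc (suc Q)) ≢next ≢e t₀ t₁ w =
  end , gap (≢next (s<s z<s)) , start , labelBlocks-windows (suc Q) (≢next ∘ s<s) (≢e ∘ cong suc) t₀ t₁ w

copies : ∀ {A : Set} → ℕ → A → (ℕ → A) → ℕ → A
copies zero    a t = t
copies (suc k) a t = a ∷ˢ copies k a t

noLabel : ℕ → Maybe ℕ
noLabel _ = nothing

copies-end : ∀ {A : Set} k {a : A} {t} → copies k a t k ≡ t 0
copies-end zero    = refl
copies-end (suc k) = copies-end k

copies-labels : ∀ k {e j a : ℕ} → copies k (just e) noLabel j ≡ just a → a ≡ e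
copies-labels (suc k) {j = zero}  refl = refl
copies-labels (suc k) {j = suc j} eq   = copies-labels k eq

copies-count : ∀ k {e : ℕ} → #[ j < k ] is-just (copies k (just e) noLabel j) ≡ k
copies-count zero    = refl
copies-count (suc k) = cong suc (copies-count k)

copies-windows : ∀ ℓ {e : ℕ} → Windows LabelWindow (suc ℓ) (copies (2 + ℓ) (just e) noLabel)
copies-windows zero    = end , tt
copies-windows (suc ℓ) = middle , copies-windows ℓ

isOdd : ℕ → Bool
isOdd j = parity j ≡ᵇ 1

isOdd-even : ∀ h → isOdd (h * 2) ≡ false
isOdd-even zero    = refl
isOdd-even (suc h) = isOdd-even h

isOdd-odd : ∀ h → isOdd (suc (h * 2)) ≡ true
isOdd-odd zero    = refl
isOdd-odd (suc h) = isOdd-odd h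

#-isOdd : ∀ h → #[ j < h * 2 ] isOdd j ≡ h
#-isOdd zero    = refl
#-isOdd (suc h) = cong suc (#-isOdd h)

isOdd-windows : ∀ h → Windows CoverWindow (h * 2) isOdd
isOdd-windows zero    = tt
isOdd-windows (suc h) = isolated , coveredˡ , isOdd-windows h

centreBlocks : ℕ → (ℕ → Bool) → ℕ → Bool
centreBlocks zero    t = t
centreBlocks (suc Q) t = false ∷ˢ true ∷ˢ false ∷ˢ centreBlocks Q t

centreBlocks-tail : ∀ Q {t} j → centreBlocks Q t (Q * 3 + j) ≡ t j
centreBlocks-tail zero    j = refl
centreBlocks-tail (suc Q) j = centreBlocks-tail Q j

centreBlocks-count : ∀ Q {t} r → #[ j < Q * 3 + r ] centreBlocks Q t j ≡ Q + #[ j < r ] t j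
centreBlocks-count zero    r = refl
centreBlocks-count (suc Q) r = cong suc (centreBlocks-count Q r)

centreBlocks-windows : ∀ Q h → Windows CoverWindow (Q * 3 + h * 2) (centreBlocks Q isOdd)
centreBlocks-windows zero          h = isOdd-windows h
centreBlocks-windows (suc zero)    h = isolated , coveredˡ , coveredʳ , isOdd-windows h
centreBlocks-windows (suc (suc Q)) h = isolated , coveredˡ , coveredʳ , centreBlocks-windows (suc Q) h

3*[q*2+r]≤[q*3+r]*2+c : ∀ q r {c} → r ≤ c → 3 * (q * 2 + r) ≤ (q * 3 + r) * 2 + c
3*[q*2+r]≤[q*3+r]*2+c q r r≤c = ≤-trans (≤-reflexive (shape q r)) (+-monoʳ-≤ ((q * 3 + r) * 2) r≤c)
  where
  shape : ∀ q r → 3 * (q * 2 + r) ≡ (q * 3 + r) * 2 + r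
  shape = solve-∀

3*[q+h]≤q*3+h*2+2 : ∀ q h → h ≤ 2 → 3 * (q + h) ≤ q * 3 + h * 2 + 2
3*[q+h]≤q*3+h*2+2 q h h≤2 = ≤-trans (≤-reflexive (shape q h)) (+-monoʳ-≤ (q * 3 + h * 2) h≤2)
  where
  shape : ∀ q h → 3 * (q + h) ≡ q * 3 + h * 2 + h
  shape = solve-∀

3*[[q+h]+[q+h]]≤[q*3+h*2]*2+2 : ∀ q h → h ≤ 1 → 3 * ((q + h) + (q + h)) ≤ (q * 3 + h * 2) * 2 + 2
3*[[q+h]+[q+h]]≤[q*3+h*2]*2+2 q h h≤1 = ≤-trans (≤-reflexive (shape q h)) (+-monoʳ-≤ ((q * 3 + h * 2) * 2) (*-monoˡ-≤ 2 h≤1))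
  where
  shape : ∀ q h → 3 * ((q + h) + (q + h)) ≡ (q * 3 + h * 2) * 2 + h * 2
  shape = solve-∀

-- The r columns after the blocks repeat the label of the first block.
cycle-labelled : ∀ {m n} Q r (L : ℕ → ℕ) → n ≡ suc Q * 3 + r → 2 ≤ m → r ≤ 2 → (∀ k → L k < m) →
                 (∀ {k} → suc k < suc Q → L k ≢ L (suc k)) → (∀ {k} → suc k ≡ suc Q → L k ≢ L 0) →
                 AllThreeEqual (C n ×ᵍ K m)
cycle-labelled {m} Q r L refl 2≤m r≤2 L<m ≢next ≢first =
  optimal (degree≤2 B) (subst Construction size-eq construction)
          (pathLike-lower-bound B m 2≤m (3*[q*2+r]≤[q*3+r]*2+c (suc Q) r r≤2))
  where
  n : ℕ
  n = suc Q * 3 + r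
  3≤n : 3 ≤ n
  3≤n = s≤s (s≤s (s≤s z≤n))
  B : PathLike n (cycᵇ n)
  B = cycle 3≤n
  s : ℕ → Maybe ℕ
  s = labelBlocks (suc Q) L (const (just (L 0)))
  open Product n m (cycᵇ n)
  windows : Windows LabelWindow n s
  windows = labelBlocks-windows (suc Q) ≢next ≢first refl refl (constant-windows middle r)
  periodic : s (suc n) ≡ s 1
  periodic = trans (cong s (sym (+-suc (suc Q * 3) r))) (labelBlocks-tail (suc Q) {L} (suc r))
  labels< : ∀ j {a} → s j ≡ just a → a < m
  labels< = labelBlocks-labels (suc Q) {L} {const (just (L 0))} L<m (λ _ eq → subst (_< m) (just-injective eq) (L<m 0))
  local : Local B LabelWindow (restrict n nothing s)
  local = cycle-local {d = nothing} {s = s} 3≤n windows (labelBlocks-tail (suc Q) {L} r) periodic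
  open SingleLabel B m s labels< local
  size-eq : #[ j < n ] is-just (s j) ≡ suc Q * 2 + r
  size-eq = trans (labelBlocks-count (suc Q) {L} r) (cong (suc Q * 2 +_) (#-true r))

path-labelled : ∀ {m n} Q r → n ≡ suc Q * 3 + r → 3 ≤ m → 2 ≤ r → r ≤ 4 → AllThreeEqual (P n ×ᵍ K m)
path-labelled Q 0 _ _ () _
path-labelled Q 1 _ _ (s≤s ()) _
path-labelled {m} Q (suc (suc ℓ)) refl 3≤m _ (s≤s (s≤s ℓ≤2)) =
  optimal (degree≤2 B) (subst Construction size-eq construction)
          (path-lower-bound 3≤m 4≤n (3*[q*2+r]≤[q*3+r]*2+c (suc Q) (2 + ℓ) (s≤s (s≤s ℓ≤2))))
  where
  n : ℕ
  n = suc Q * 3 + (2 + ℓ)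
  4≤n : 4 ≤ n
  4≤n = s≤s (s≤s (s≤s (≤-trans (s≤s z≤n) (m≤n+m (2 + ℓ) (Q * 3)))))
  B : PathLike n pathᵇ
  B = path z<s
  e : ℕ
  e = parity (suc Q)
  t s : ℕ → Maybe ℕ
  t = copies (2 + ℓ) (just e) noLabel
  s = labelBlocks (suc Q) parity t
  open Product n m pathᵇ
  windows : Windows LabelWindow (suc (suc (Q * 3 + (2 + ℓ)))) s
  windows = subst (λ k → Windows LabelWindow (suc (suc k)) s) (sym (+-suc (Q * 3) (suc ℓ)))
              (labelBlocks-windows (suc Q) {parity} {t} {e} (λ {k} _ → parity-≢ k) (λ { refl → parity-≢ Q })
                                   refl refl (copies-windows ℓ))
  parity<m : ∀ k → parity k < m
  parity<m k = <-≤-trans (parity<2 k) (≤-trans (n≤1+n 2) 3≤m)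
  labels< : ∀ j {a} → s j ≡ just a → a < m
  labels< = labelBlocks-labels (suc Q) {parity} {t} parity<m
              (λ j eq → subst (_< m) (sym (copies-labels (2 + ℓ) {j = j} eq)) (parity<m (suc Q)))
  local : Local B LabelWindow (restrict n nothing s)
  local = path-local {d = nothing} {s = s} z<s (start , windows)
            (trans (labelBlocks-tail (suc Q) {parity} (2 + ℓ)) (copies-end (2 + ℓ) {just e} {noLabel}))
  open SingleLabel B m s labels< local
  size-eq : #[ j < n ] is-just (s j) ≡ suc Q * 2 + (2 + ℓ)
  size-eq = trans (labelBlocks-count (suc Q) {parity} (2 + ℓ)) (cong (suc Q * 2 +_) (copies-count (2 + ℓ)))

path-opposite-parity : ∀ {n i j} → i < n → j < n → T (pathᵇ j i) → parity j ≡ parity (suc i)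
path-opposite-parity {i = i} {j} _ _ x with pathᵇ⇒ {j} {i} x
... | inj₁ refl = refl
... | inj₂ refl = refl

odd-before-even : ∀ k → parity (suc k) ≡ 0 → parity k ≡ 1
odd-before-even zero          ()
odd-before-even (suc zero)    _    = refl
odd-before-even (suc (suc k)) even = odd-before-even k even

cycle-opposite-parity : ∀ {n} → parity n ≡ 0 → ∀ {i j} → i < n → j < n → T (cycᵇ n j i) → parity j ≡ parity (suc i)
cycle-opposite-parity {suc k} even {i} {j} _ _ x with cycᵇ⇒ {suc k} {j} {i} x
... | forward refl     = refl
... | backward refl    = refl
... | wrap refl refl   = odd-before-even k even
... | wrap⁻¹ refl refl = sym even

path-doubled : ∀ {n} Q h → n ≡ suc Q * 3 + h * 2 → h ≤ 2 → AllThreeEqual (P n ×ᵍ K 2)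
path-doubled Q h refl h≤2 =
  optimal (degree≤2 B) (subst Construction size-eq construction)
          (two-layer-lower-bound B path-opposite-parity {suc Q + h} (3*[q+h]≤q*3+h*2+2 (suc Q) h h≤2))
  where
  n : ℕ
  n = suc Q * 3 + h * 2
  B : PathLike n pathᵇ
  B = path z<s
  S : ℕ → Bool
  S = centreBlocks (suc Q) isOdd
  open Product n 2 pathᵇ
  local : Local B CoverWindow (restrict n false S)
  local = path-local {d = false} {s = S} z<s (windows-pad {s = S} n coveredʳ (centreBlocks-windows (suc Q) h))
            (trans (centreBlocks-tail (suc Q) (h * 2)) (isOdd-even h))
  open Doubled B S local
  |S| : #[ j < n ] S j ≡ suc Q + h
  |S| = trans (centreBlocks-count (suc Q) (h * 2)) (cong (suc Q +_) (#-isOdd h))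
  size-eq : #[ j < n ] S j + #[ j < n ] S j ≡ (suc Q + h) + (suc Q + h)
  size-eq = cong₂ _+_ |S| |S|

cycle-doubled : ∀ {n} Q h → n ≡ suc Q * 3 + h * 2 → h ≤ 2 → h ≤ 1 ⊎ parity (suc Q * 3 + h * 2) ≡ 0 →
                AllThreeEqual (C n ×ᵍ K 2)
cycle-doubled Q h refl h≤2 h≤1⊎even = optimal (degree≤2 B) (subst Construction size-eq construction) lower
  where
  n : ℕ
  n = suc Q * 3 + h * 2
  3≤n : 3 ≤ n
  3≤n = s≤s (s≤s (s≤s z≤n))
  B : PathLike n (cycᵇ n)
  B = cycle 3≤n
  S : ℕ → Bool
  S = centreBlocks (suc Q) isOdd
  open Product n 2 (cycᵇ n)
  periodic : S (suc n) ≡ S 1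
  periodic = trans (cong S (sym (+-suc (suc Q * 3) (h * 2)))) (trans (centreBlocks-tail (suc Q) (suc (h * 2))) (isOdd-odd h))
  local : Local B CoverWindow (restrict n false S)
  local = cycle-local {d = false} {s = S} 3≤n (centreBlocks-windows (suc Q) h)
            (trans (centreBlocks-tail (suc Q) (h * 2)) (isOdd-even h)) periodic
  open Doubled B S local
  |S| : #[ j < n ] S j ≡ suc Q + h
  |S| = trans (centreBlocks-count (suc Q) (h * 2)) (cong (suc Q +_) (#-isOdd h))
  size-eq : #[ j < n ] S j + #[ j < n ] S j ≡ (suc Q + h) + (suc Q + h)
  size-eq = cong₂ _+_ |S| |S|
  lower : LowerBound (C n ×ᵍ K 2) ((suc Q + h) + (suc Q + h))
  lower = [ (λ h≤1 → pathLike-lower-bound B 2 ≤-refl (3*[[q+h]+[q+h]]≤[q*3+h*2]*2+2 (suc Q) h h≤1))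
          , (λ even → two-layer-lower-bound B (cycle-opposite-parity even) {suc Q + h} (3*[q+h]≤q*3+h*2+2 (suc Q) h h≤2))
          ]′ h≤1⊎even

colour₃ : ℕ → ℕ → ℕ
colour₃ q k = if suc k ≡ᵇ q then 2 else parity k

colour₃-≢ : ∀ {q k} → suc k < q → colour₃ q k ≢ colour₃ q (suc k)
colour₃-≢ {q} {k} k+1<q rewrite ≢⇒≡ᵇ≡false (<⇒≢ k+1<q) with suc (suc k) ≟ q
... | yes eq rewrite ≡⇒≡ᵇ≡true eq = <⇒≢ (parity<2 k)
... | no  ne rewrite ≢⇒≡ᵇ≡false ne = parity-≢ k

colour₃-last : ∀ {q k} → 2 ≤ q → suc k ≡ q → colour₃ q k ≢ colour₃ q 0
colour₃-last {q} 2≤q refl rewrite ≡⇒≡ᵇ≡true {q} refl | ≢⇒≡ᵇ≡false {1} {q} (<⇒≢ 2≤q) = λ ()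

colour₃<3 : ∀ q k → colour₃ q k < 3
colour₃<3 q k with suc k ≡ᵇ q
... | true  = ≤-refl
... | false = <-trans (parity<2 k) (n<1+n 2)

parity-last : ∀ {q k} → parity q ≡ 0 → suc k ≡ q → parity k ≢ parity 0
parity-last {k = k} even refl p≡0 with () ← trans (sym (odd-before-even k even)) p≡0

parity-cases : ∀ k → parity k ≡ 0 ⊎ parity k ≡ 1
parity-cases zero          = inj₁ refl
parity-cases (suc zero)    = inj₂ refl
parity-cases (suc (suc k)) = parity-cases k

parity-*3 : ∀ a → parity (a * 3) ≡ parity a
parity-*3 zero    = refl
parity-*3 (suc a) = trans (parity-suc (a * 3)) (trans (cong (1 ∸_) (parity-*3 a)) (sym (parity-suc a)))

one-more-block : ∀ Q r → suc Q * 3 + (3 + r) ≡ suc (suc Q) * 3 + r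
one-more-block Q r = x∙yz≈y∙xz (suc Q * 3) 3 r

-- With m = 2 and an odd number of blocks the labels cannot alternate around the cycle.
cycle-odd-blocks : ∀ {n} Q r → n ≡ suc (suc Q) * 3 + r → r ≤ 2 → parity (suc (suc Q)) ≡ 1 → AllThreeEqual (C n ×ᵍ K 2)
cycle-odd-blocks Q 0 eq _ _   = cycle-doubled (suc Q) 0 eq z≤n (inj₁ z≤n)
cycle-odd-blocks Q 1 eq _ odd = cycle-doubled Q 2 (trans eq (sym (one-more-block Q 1))) ≤-refl (inj₂ even)
  where
  even : parity (suc Q * 3 + 4) ≡ 0
  even = trans (cong parity (+-comm (suc Q * 3) 4)) (trans (parity-*3 (suc Q)) (trans (parity-suc Q) (cong (1 ∸_) odd)))
cycle-odd-blocks Q 2 eq _ _   = cycle-doubled (suc Q) 1 eq (s≤s z≤n) (inj₁ ≤-refl)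
cycle-odd-blocks Q (suc (suc (suc _))) _ (s≤s (s≤s ())) _

C×K-allThreeEqual : ∀ {m n} Q r → n ≡ suc (suc Q) * 3 + r → 2 ≤ m → r ≤ 2 → AllThreeEqual (C n ×ᵍ K m)
C×K-allThreeEqual Q r eq 2≤m r≤2 with m≤n⇒m<n∨m≡n 2≤m | parity-cases (suc (suc Q))
... | inj₁ 3≤m  | _ = cycle-labelled (suc Q) r (colour₃ (suc (suc Q))) eq 2≤m r≤2
                        (λ k → <-≤-trans (colour₃<3 (suc (suc Q)) k) 3≤m) (colour₃-≢ {suc (suc Q)})
                        (colour₃-last {suc (suc Q)} (s≤s (s≤s z≤n)))
... | inj₂ refl | inj₁ even = cycle-labelled (suc Q) r parity eq ≤-refl r≤2 parity<2 (λ {k} _ → parity-≢ k) (parity-last even)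
... | inj₂ refl | inj₂ odd  = cycle-odd-blocks Q r eq r≤2 odd

P×K-allThreeEqual : ∀ {m n} Q r → n ≡ suc (suc Q) * 3 + r → 2 ≤ m → r ≤ 2 → AllThreeEqual (P n ×ᵍ K m)
P×K-allThreeEqual Q r eq 2≤m r≤2 with m≤n⇒m<n∨m≡n 2≤m | r | r≤2
... | inj₁ 3≤m  | 0 | _ = path-labelled Q 3 (trans eq (sym (one-more-block Q 0))) 3≤m (s≤s (s≤s z≤n)) (s≤s (s≤s (s≤s z≤n)))
... | inj₁ 3≤m  | 1 | _ = path-labelled Q 4 (trans eq (sym (one-more-block Q 1))) 3≤m (s≤s (s≤s z≤n)) ≤-refl
... | inj₁ 3≤m  | 2 | _ = path-labelled (suc Q) 2 eq 3≤m ≤-refl (s≤s (s≤s z≤n))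
... | inj₂ refl | 0 | _ = path-doubled (suc Q) 0 eq z≤n
... | inj₂ refl | 1 | _ = path-doubled Q 2 (trans eq (sym (one-more-block Q 1))) ≤-refl
... | inj₂ refl | 2 | _ = path-doubled (suc Q) 1 eq (s≤s z≤n)
... | _         | suc (suc (suc _)) | s≤s (s≤s ())

at-least-two-blocks : ∀ n → 6 ≤ n → ∃[ Q ] ∃[ r ] n ≡ suc (suc Q) * 3 + r × r ≤ 2
at-least-two-blocks n 6≤n with n / 3 | n % 3 | m≡m%n+[m/n]*n n 3 | m%n<n n 3
... | suc (suc Q) | r | eq   | r<3 = Q , r , trans eq (+-comm r _) , s≤s⁻¹ r<3
... | 0           | r | refl | r<3 = ⊥-elim (<⇒≱ (subst (_< 6) (sym (+-identityʳ r)) (≤-trans r<3 (m≤m+n 3 3))) 6≤n)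
... | 1           | r | refl | r<3 = ⊥-elim (<⇒≱ (+-monoˡ-< 3 r<3) 6≤n)

proposition4p6 : (m n : ℕ) → 2 ≤ m → 6 ≤ n →
    AllThreeEqual (C n ×ᵍ K m) × AllThreeEqual (P n ×ᵍ K m)
proposition4p6 m n 2≤m 6≤n =
  let Q , r , n≡ , r≤2 = at-least-two-blocks n 6≤n
  in C×K-allThreeEqual Q r n≡ 2≤m r≤2 , P×K-allThreeEqual Q r n≡ 2≤m r≤2
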